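{- Let $G_1$ be any graph and define $G_{n+1}=S_{n+3}G_n$ for all $n\ge1$. If $n\geq 2$, then $H^{\square}_k(G_n)=0$ for $k=1,\dots,n-1$.
   Context: All graphs are simple, connected, undirected; a graph map sends equal-or-adjacent vertices to equal-or-adjacent vertices. $I_m$ is the path graph on $\{0,\dots,m\}$, $\times$ the Cartesian product. For $t\ge2$, $S_tG$ is obtained from $G\times I_t$ by contracting $G\times\{0\}$ to one vertex and $G\times\{t\}$ to one vertex. Discrete cubical homology: $Q_0$ is a single vertex and $Q_k=I_1^k$ for $k\ge1$; a $k$-cube of $G$ is a graph map $\sigma:Q_k\to G$; $D_i^{ - }\sigma$ (resp. $D_i^+\sigma$) is the $(k-1)$-cube obtained by inserting $0$ (resp. $1$) in the $i$th coordinate; $\sigma$ is degenerate if $D_i^-\sigma=D_i^+\sigma$ for some $i$; $C_k(G)$ is the free abelian group on $k$-cubes modulo the subgroup generated by degenerate $k$-cubes; $\partial_k\sigma=\sum_{i=1}^k(-1)^i(D_i^-\sigma-D_i^+\sigma)$; $H^{\square}_k(G)=\ker\partial_k/\operatorname{im}\partial_{k+1}$. -}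

module Defs where

open import Data.Nat as ℕ using (ℕ; zero; suc; _∸_; _≤_; _<_; z≤n; s≤s)
open import Data.Nat.Properties using (1+n≢n)
open import Data.Integer as ℤ using (ℤ; +_; -_)
open import Data.Fin using (Fin; toℕ)
open import Data.List using (List; []; _∷_; _++_; concatMap; map; allFin)
open import Data.Vec using (Vec; []; _∷_; insertAt)
open import Data.Bool using (Bool; true; false; not)
open import Data.Product using (Σ; ∃; _×_; _,_)
open import Data.Sum using (_⊎_; inj₁; inj₂)
open import Data.Empty using (⊥)
open import Relation.Nullary using (¬_)
open import Relation.Binary.PropositionalEquality using (_≡_; refl; sym)
open import Relation.Binary.Construct.Closure.ReflexiveTransitive using (Star)

record Graph : Set₁ where
  field
    V     : Set
    E     : V → V → Set
    E-sym : ∀ {u v} → E u v → E v u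
    E-irr : ∀ {v} → ¬ E v v
open Graph public

Connected : Graph → Set
Connected G = V G × (∀ u v → Star (E G) u v)

-- S_t G: G × I_t with G×{0} contracted to `bot` and G×{t} to `top`.
-- Remaining vertices (v , ℓ) with level ℓ ∈ {1,…,t-1}, encoded as
-- mid v i with i : Fin (t ∸ 1) and level = toℕ i + 1.

data SV (A : Set) (t : ℕ) : Set where
  bot : SV A t
  top : SV A t
  mid : A → Fin (t ∸ 1) → SV A t

module _ (G : Graph) (t : ℕ) where
  SE : SV (V G) t → SV (V G) t → Set
  SE bot       (mid v i) = toℕ i ≡ 0
  SE (mid v i) bot       = toℕ i ≡ 0
  SE top       (mid v i) = suc (toℕ i) ≡ t ∸ 1
  SE (mid v i) top       = suc (toℕ i) ≡ t ∸ 1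
  SE (mid v i) (mid w j) =
    (E G v w × i ≡ j) ⊎ (v ≡ w × (suc (toℕ i) ≡ toℕ j ⊎ suc (toℕ j) ≡ toℕ i))
  SE bot bot = ⊥
  SE bot top = ⊥
  SE top bot = ⊥
  SE top top = ⊥

  SE-sym : ∀ {x y} → SE x y → SE y x
  SE-sym {bot} {mid v i} e = e
  SE-sym {mid v i} {bot} e = e
  SE-sym {top} {mid v i} e = e
  SE-sym {mid v i} {top} e = e
  SE-sym {mid v i} {mid w j} (inj₁ (e , p)) = inj₁ (E-sym G e , sym p)
  SE-sym {mid v i} {mid w j} (inj₂ (p , inj₁ q)) = inj₂ (sym p , inj₂ q)
  SE-sym {mid v i} {mid w j} (inj₂ (p , inj₂ q)) = inj₂ (sym p , inj₁ q)

  SE-irr : ∀ {x} → ¬ SE x x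
  SE-irr {bot} ()
  SE-irr {top} ()
  SE-irr {mid v i} (inj₁ (e , _)) = E-irr G e
  SE-irr {mid v i} (inj₂ (_ , inj₁ q)) = 1+n≢n q
  SE-irr {mid v i} (inj₂ (_ , inj₂ q)) = 1+n≢n q

-- S_t G, defined for t ≥ 2 (the proof is only there to enforce t ≥ 2)
S : (t : ℕ) → 2 ≤ t → Graph → Graph
S t _ G = record
  { V = SV (V G) t ; E = SE G t ; E-sym = SE-sym G t ; E-irr = SE-irr G t }

-- The sequence G_1 = G₁, G_{n+1} = S_{n+3} G_n  (n ≥ 1).
-- (Index 0 is unused; set to G₁ by convention.)
Gseq : Graph → ℕ → Graph
Gseq G₁ zero = G₁
Gseq G₁ (suc zero) = G₁
Gseq G₁ (suc (suc n)) = S (3 ℕ.+ suc n) (s≤s (s≤s z≤n)) (Gseq G₁ (suc n))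

data QAdj : {k : ℕ} → Vec Bool k → Vec Bool k → Set where
  here  : ∀ {k b} {x : Vec Bool k} → QAdj (b ∷ x) (not b ∷ x)
  there : ∀ {k b} {x y : Vec Bool k} → QAdj x y → QAdj (b ∷ x) (b ∷ y)

record Cube (G : Graph) (k : ℕ) : Set where
  constructor cube
  field
    fun : Vec Bool k → V G
    map-adj : ∀ {x y} → QAdj x y → fun x ≡ fun y ⊎ E G (fun x) (fun y)
open Cube public

insert-adj : ∀ {k} {x y : Vec Bool k} (i : Fin (suc k)) (c : Bool) →
             QAdj x y → QAdj (insertAt x i c) (insertAt y i c)
insert-adj Fin.zero c a = there a
  where import Data.Fin as Fin
insert-adj (Data.Fin.suc i) c here = here
insert-adj (Data.Fin.suc i) c (there a) = there (insert-adj i c a)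

-- face D_{i+1}^{-} (c = false) / D_{i+1}^{+} (c = true), i : Fin (suc m)
face : ∀ {G m} → Fin (suc m) → Bool → Cube G (suc m) → Cube G m
face i c σ = cube (λ x → fun σ (insertAt x i c)) (λ a → map-adj σ (insert-adj i c a))

Degenerate : ∀ {G k} → Cube G k → Set
Degenerate {k = zero} σ = ⊥
Degenerate {k = suc m} σ =
  Σ (Fin (suc m)) λ i → ∀ x → fun (face i false σ) x ≡ fun (face i true σ) x

-- Chains: formal ℤ-linear combinations of k-cubes (as lists), with the
-- equivalence relation presenting C_k(G) = ℤ[k-cubes] / ⟨degenerate⟩.

Chain : Graph → ℕ → Set
Chain G k = List (ℤ × Cube G k)

data _≈_ {G : Graph} {k : ℕ} : Chain G k → Chain G k → Set where
  ≈refl  : ∀ {a} → a ≈ a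
  ≈sym   : ∀ {a b} → a ≈ b → b ≈ a
  ≈trans : ∀ {a b c} → a ≈ b → b ≈ c → a ≈ c
  ≈++    : ∀ {a b c d} → a ≈ b → c ≈ d → (a ++ c) ≈ (b ++ d)
  ≈swap  : ∀ {x y} → (x ∷ y ∷ []) ≈ (y ∷ x ∷ [])
  ≈merge : ∀ {m n σ τ} → (∀ x → fun σ x ≡ fun τ x) →
           ((m , σ) ∷ (n , τ) ∷ []) ≈ ((m ℤ.+ n , σ) ∷ [])
  ≈zero  : ∀ {σ} → ((+ 0 , σ) ∷ []) ≈ []
  ≈degen : ∀ {n σ} → Degenerate σ → ((n , σ) ∷ []) ≈ []

sgn : ℕ → ℤ
sgn zero = + 1
sgn (suc i) = - sgn i

∂cube : ∀ {G m} → Cube G (suc m) → Chain G m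
∂cube {m = m} σ = concatMap
  (λ i → (sgn (suc (toℕ i)) , face i false σ) ∷ (- sgn (suc (toℕ i)) , face i true σ) ∷ [])
  (allFin (suc m))

∂ : ∀ {G m} → Chain G (suc m) → Chain G m
∂ = concatMap (λ { (n , σ) → map (λ { (a , τ) → (n ℤ.* a , τ) }) (∂cube σ) })

-- H^□_k(G) = 0 : every k-cycle is a k-boundary (∂_0 = 0)
HomologyVanishes : Graph → ℕ → Set
HomologyVanishes G zero =
  ∀ (c : Chain G 0) → ∃ λ (d : Chain G 1) → c ≈ ∂ d
HomologyVanishes G (suc m) =
  ∀ (c : Chain G (suc m)) → ∂ c ≈ [] → ∃ λ (d : Chain G (suc (suc m))) → c ≈ ∂ d

-- S_t G is covered by the cones L = S_t G − top and U = S_t G − bot, which contract by sliding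
-- every level towards the apex, and L ∩ U ≅ G × I_(t−2) deformation retracts onto G.
-- A cube of dimension below t cannot meet both apexes, so a k-cycle (k < t) splits into a part
-- in L and a part in U; their common boundary is a reduced (k−1)-cycle of L ∩ U, hence bounds a
-- chain e there once H̃_(k−1)(G) = 0. Correcting both parts by e leaves cycles in the cones,
-- which bound. Starting from H̃_0(G₁) = 0 (connectedness), induction gives H̃_k(G_n) = 0 for
-- k < n. The homotopy invariance used for the contractions comes from prisms in the edge graph,
-- which also give ∂∂ = 0 and the vanishing of boundaries of degenerate cubes.
module Submission where

open import Defs
open import Data.Nat as ℕ using (ℕ; zero; suc; _≤_; _<_; z≤n; s≤s; _∸_)
import Data.Nat.Properties as ℕP
open import Data.Integer as ℤ using (ℤ; +_; -_; 0ℤ; 1ℤ; -1ℤ)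
import Data.Integer.Properties as ℤP
open import Data.Fin using (Fin; toℕ; inject₁; opposite; fromℕ) renaming (zero to fz; suc to fs)
import Data.Fin.Properties as FP
open import Data.List using (List; []; _∷_; _++_; concatMap; map; allFin)
open import Data.List.Properties using (++-identityʳ; ++-assoc; map-++; concatMap-map; map-tabulate)
open import Data.List.Relation.Unary.All as All using (All; []; _∷_)
open import Data.List.Relation.Unary.All.Properties using (++⁺; map⁺)
open import Data.Vec using (Vec; []; _∷_; insertAt)
open import Data.Bool using (Bool; true; false; T; _∧_)
open import Data.Bool.Properties using (T-∧)
open import Data.Product using (Σ; _×_; _,_; proj₁; proj₂)
open import Data.Sum using (_⊎_; inj₁; inj₂)
open import Data.Empty using (⊥; ⊥-elim)
open import Data.Unit using (⊤; tt)
open import Function using (_∘_; id; Equivalence)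
open import Relation.Nullary using (Dec; yes; no; ¬_)
open import Relation.Nullary.Decidable using (T?)
open import Relation.Binary.PropositionalEquality
open import Relation.Binary.Construct.Closure.ReflexiveTransitive using (Star; ε; _◅_; _◅◅_; reverse)
open import Relation.Binary.Bundles using (Setoid)
import Relation.Binary.Reasoning.Setoid as SetoidReasoning

-- Graphs whose vertices form a setoid (the edge graph and induced subgraphs have vertices
-- carrying proofs); Near is "equal or adjacent", the relation preserved by graph maps.
record RGraph : Set₁ where
  field
    Vtx        : Set
    Same       : Vtx → Vtx → Set
    same-refl  : ∀ {u} → Same u u
    same-sym   : ∀ {u v} → Same u v → Same v u
    same-trans : ∀ {u v w} → Same u v → Same v w → Same u w
    Near       : Vtx → Vtx → Set
    near-sym   : ∀ {u v} → Near u v → Near v u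
open RGraph public

-- Cubes, chains and the relation presenting C_k, as in Defs but over a setoid graph;
-- on toRGraph G they are those of Defs.
record RCube (X : RGraph) (k : ℕ) : Set where
  constructor rcube
  field
    corner      : Vec Bool k → Vtx X
    corner-near : ∀ {x y} → QAdj x y → Near X (corner x) (corner y)
open RCube public

infix 4 _≗ᶜ_ _∼_

_≗ᶜ_ : ∀ {X k} → RCube X k → RCube X k → Set
_≗ᶜ_ {X} σ τ = ∀ x → Same X (corner σ x) (corner τ x)

facet : ∀ {X m} → Fin (suc m) → Bool → RCube X (suc m) → RCube X m
facet i b σ = rcube (λ x → corner σ (insertAt x i b)) (λ a → corner-near σ (insert-adj i b a))

IsDegenerate : ∀ {X k} → RCube X k → Set
IsDegenerate {k = zero}  σ = ⊥
IsDegenerate {k = suc m} σ = Σ (Fin (suc m)) λ i → facet i false σ ≗ᶜ facet i true σ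

RChain : RGraph → ℕ → Set
RChain X k = List (ℤ × RCube X k)

data _∼_ {X : RGraph} {k : ℕ} : RChain X k → RChain X k → Set where
  ∼-refl   : ∀ {a} → a ∼ a
  ∼-sym    : ∀ {a b} → a ∼ b → b ∼ a
  ∼-trans  : ∀ {a b c} → a ∼ b → b ∼ c → a ∼ c
  ++-cong  : ∀ {a b c d} → a ∼ b → c ∼ d → a ++ c ∼ b ++ d
  ∼-swap   : ∀ {x y} → x ∷ y ∷ [] ∼ y ∷ x ∷ []
  ∼-merge  : ∀ {m n σ τ} → σ ≗ᶜ τ → (m , σ) ∷ (n , τ) ∷ [] ∼ (m ℤ.+ n , σ) ∷ []
  ∼-zero   : ∀ {σ} → (+ 0 , σ) ∷ [] ∼ []
  ∼-degen  : ∀ {n σ} → IsDegenerate σ → (n , σ) ∷ [] ∼ []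

∼-setoid : RGraph → ℕ → Setoid _ _
∼-setoid X k = record
  { Carrier = RChain X k ; _≈_ = _∼_
  ; isEquivalence = record { refl = ∼-refl ; sym = ∼-sym ; trans = ∼-trans } }

module ∼-Reasoning {X : RGraph} {k : ℕ} = SetoidReasoning (∼-setoid X k)

scale : ∀ {X k} → ℤ → RChain X k → RChain X k
scale n = map λ (m , σ) → (n ℤ.* m , σ)

neg : ∀ {X k} → RChain X k → RChain X k
neg = scale -1ℤ

[_]ᶜ : ∀ {X k} → RCube X k → RChain X k
[ σ ]ᶜ = (1ℤ , σ) ∷ []

linear : ∀ {X Y k j} → (RCube X k → RChain Y j) → RChain X k → RChain Y j
linear F = concatMap λ (n , σ) → scale n (F σ)

module _ {X : RGraph} {k : ℕ} where
  private
    C = RChain X k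

  ∼-reflexive : {a b : C} → a ≡ b → a ∼ b
  ∼-reflexive refl = ∼-refl

  ++-congˡ : ∀ (c : C) {a b} → a ∼ b → c ++ a ∼ c ++ b
  ++-congˡ c p = ++-cong {a = c} ∼-refl p

  ++-congʳ : ∀ {a b : C} c → a ∼ b → a ++ c ∼ b ++ c
  ++-congʳ c p = ++-cong p ∼-refl

  ∷-cong : ∀ {x} {a b : C} → a ∼ b → x ∷ a ∼ x ∷ b
  ∷-cong {x} = ++-congˡ (x ∷ [])

  ∷-to-end : ∀ x (b : C) → x ∷ b ∼ b ++ x ∷ []
  ∷-to-end x []      = ∼-refl
  ∷-to-end x (y ∷ b) = ∼-trans (++-cong {a = x ∷ y ∷ []} ∼-swap ∼-refl) (∷-cong (∷-to-end x b))

  ++-comm-∼ : ∀ (a b : C) → a ++ b ∼ b ++ a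
  ++-comm-∼ []      b = ∼-reflexive (sym (++-identityʳ b))
  ++-comm-∼ (x ∷ a) b = ∼-trans (∷-cong (++-comm-∼ a b))
    (∼-trans (++-congʳ a (∷-to-end x b)) (∼-reflexive (++-assoc b (x ∷ []) a)))

  ++-interchange : ∀ (a b c d : C) → (a ++ b) ++ (c ++ d) ∼ (a ++ c) ++ (b ++ d)
  ++-interchange a b c d = begin
      (a ++ b) ++ (c ++ d)  ≡⟨ ++-assoc a b (c ++ d) ⟩
      a ++ b ++ c ++ d      ≡⟨ cong (a ++_) (++-assoc b c d) ⟨
      a ++ ((b ++ c) ++ d)  ≈⟨ ++-congˡ a (++-congʳ d (++-comm-∼ b c)) ⟩
      a ++ ((c ++ b) ++ d)  ≡⟨ cong (a ++_) (++-assoc c b d) ⟩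
      a ++ c ++ b ++ d      ≡⟨ ++-assoc a c (b ++ d) ⟨
      (a ++ c) ++ (b ++ d)  ∎
    where
    open ∼-Reasoning

  coeff-cong : ∀ {m n} {σ : RCube X k} → m ≡ n → (m , σ) ∷ [] ∼ (n , σ) ∷ []
  coeff-cong refl = ∼-refl

  cube-cong : ∀ {n} {σ τ : RCube X k} → σ ≗ᶜ τ → (n , σ) ∷ [] ∼ (n , τ) ∷ []
  cube-cong {n} {σ} {τ} e = begin
    (n , σ) ∷ []                ≈⟨ ++-congʳ ((n , σ) ∷ []) ∼-zero ⟨
    (+ 0 , τ) ∷ (n , σ) ∷ []    ≈⟨ ∼-merge (λ x → same-sym X (e x)) ⟩
    (+ 0 ℤ.+ n , τ) ∷ []        ≈⟨ coeff-cong (ℤP.+-identityˡ n) ⟩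
    (n , τ) ∷ []                ∎
    where open ∼-Reasoning

  cube-cong₂ : ∀ {m m′ n n′} {σ σ′ τ τ′ : RCube X k} → m ≡ m′ → n ≡ n′ → σ ≗ᶜ σ′ → τ ≗ᶜ τ′ →
               (m , σ) ∷ (n , τ) ∷ [] ∼ (m′ , σ′) ∷ (n′ , τ′) ∷ []
  cube-cong₂ refl refl e f = ++-cong {a = _ ∷ []} (cube-cong e) (cube-cong f)

  cancel-pair : ∀ {m n} {σ τ : RCube X k} → σ ≗ᶜ τ → m ℤ.+ n ≡ + 0 → (m , σ) ∷ (n , τ) ∷ [] ∼ []
  cancel-pair e p = ∼-trans (∼-merge e) (∼-trans (coeff-cong p) ∼-zero)

  scale-++ : ∀ n (a b : C) → scale n (a ++ b) ≡ scale n a ++ scale n b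
  scale-++ n = map-++ _

  scale-cong : ∀ n {a b : C} → a ∼ b → scale n a ∼ scale n b
  scale-cong n ∼-refl        = ∼-refl
  scale-cong n (∼-sym p)     = ∼-sym (scale-cong n p)
  scale-cong n (∼-trans p q) = ∼-trans (scale-cong n p) (scale-cong n q)
  scale-cong n (++-cong {a} {b} {c} {d} p q) =
    ∼-trans (∼-reflexive (scale-++ n a c))
      (∼-trans (++-cong (scale-cong n p) (scale-cong n q)) (∼-reflexive (sym (scale-++ n b d))))
  scale-cong n ∼-swap        = ∼-swap
  scale-cong n (∼-merge {m} {m′} e) = ∼-trans (∼-merge e) (coeff-cong (sym (ℤP.*-distribˡ-+ n m m′)))
  scale-cong n ∼-zero        = ∼-trans (coeff-cong (ℤP.*-zeroʳ n)) ∼-zero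
  scale-cong n (∼-degen d)   = ∼-degen d

  scale-scale : ∀ m n (a : C) → scale m (scale n a) ≡ scale (m ℤ.* n) a
  scale-scale m n []            = refl
  scale-scale m n ((c , σ) ∷ a) =
    cong₂ _∷_ (cong (_, σ) (sym (ℤP.*-assoc m n c))) (scale-scale m n a)

  scale-1 : ∀ (a : C) → scale 1ℤ a ≡ a
  scale-1 []            = refl
  scale-1 ((c , σ) ∷ a) = cong₂ _∷_ (cong (_, σ) (ℤP.*-identityˡ c)) (scale-1 a)

  scale-0 : ∀ (a : C) → scale 0ℤ a ∼ []
  scale-0 []            = ∼-refl
  scale-0 ((c , σ) ∷ a) = ++-cong {a = (0ℤ , σ) ∷ []} {b = []} ∼-zero (scale-0 a)

  scale-+ : ∀ m n (a : C) → scale m a ++ scale n a ∼ scale (m ℤ.+ n) a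
  scale-+ m n []            = ∼-refl
  scale-+ m n ((c , σ) ∷ a) =
    ∼-trans (++-interchange ((m ℤ.* c , σ) ∷ []) (scale m a) ((n ℤ.* c , σ) ∷ []) (scale n a))
      (++-cong (∼-trans (∼-merge (λ x → same-refl X)) (coeff-cong (sym (ℤP.*-distribʳ-+ c m n))))
               (scale-+ m n a))

  neg-++ : ∀ (a b : C) → neg (a ++ b) ≡ neg a ++ neg b
  neg-++ = scale-++ -1ℤ

  neg-cong : ∀ {a b : C} → a ∼ b → neg a ∼ neg b
  neg-cong = scale-cong -1ℤ


  neg-inverseʳ : ∀ (a : C) → a ++ neg a ∼ []
  neg-inverseʳ []            = ∼-refl
  neg-inverseʳ ((n , σ) ∷ a) =
    ∼-trans (∷-cong (++-comm-∼ a ((-1ℤ ℤ.* n , σ) ∷ neg a)))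
      (++-cong {a = (n , σ) ∷ (-1ℤ ℤ.* n , σ) ∷ []} {b = []}
        (cancel-pair (λ x → same-refl X)
          (trans (cong (λ z → n ℤ.+ z) (ℤP.-1*i≡-i n)) (ℤP.+-inverseʳ n)))
        (∼-trans (++-comm-∼ (neg a) a) (neg-inverseʳ a)))

  neg-inverseˡ : ∀ (a : C) → neg a ++ a ∼ []
  neg-inverseˡ a = ∼-trans (++-comm-∼ (neg a) a) (neg-inverseʳ a)

  ++-∼[]⇒∼neg : ∀ (a b : C) → a ++ b ∼ [] → a ∼ neg b
  ++-∼[]⇒∼neg a b p = begin
    a                  ≡⟨ ++-identityʳ a ⟨
    a ++ []            ≈⟨ ++-congˡ a (neg-inverseʳ b) ⟨
    a ++ (b ++ neg b)  ≡⟨ ++-assoc a b (neg b) ⟨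
    (a ++ b) ++ neg b  ≈⟨ ++-congʳ (neg b) p ⟩
    neg b              ∎
    where open ∼-Reasoning

record Descends {X Y k j} (F : RCube X k → RChain Y j) : Set where
  field
    resp-≗ᶜ        : ∀ {σ τ} → σ ≗ᶜ τ → F σ ∼ F τ
    degenerate-null : ∀ {σ} → IsDegenerate σ → F σ ∼ []

module _ {X Y : RGraph} {k j : ℕ} where

  linear-++ : ∀ (F : RCube X k → RChain Y j) (a b : RChain X k) →
              linear F (a ++ b) ≡ linear F a ++ linear F b
  linear-++ F []      b = refl
  linear-++ F (x ∷ a) b = trans (cong (_ ++_) (linear-++ F a b)) (sym (++-assoc _ (linear F a) (linear F b)))

  linear-scale : ∀ (F : RCube X k → RChain Y j) n (a : RChain X k) →
                 linear F (scale n a) ≡ scale n (linear F a)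
  linear-scale F n []            = refl
  linear-scale F n ((c , σ) ∷ a) =
    trans (cong₂ _++_ (sym (scale-scale n c (F σ))) (linear-scale F n a))
          (sym (scale-++ n (scale c (F σ)) (linear F a)))

  linear-neg : ∀ (F : RCube X k → RChain Y j) (a : RChain X k) → linear F (neg a) ≡ neg (linear F a)
  linear-neg F = linear-scale F -1ℤ

  linear-cong : ∀ {F : RCube X k → RChain Y j} → Descends F → ∀ {a b} → a ∼ b → linear F a ∼ linear F b
  linear-cong d ∼-refl        = ∼-refl
  linear-cong d (∼-sym p)     = ∼-sym (linear-cong d p)
  linear-cong d (∼-trans p q) = ∼-trans (linear-cong d p) (linear-cong d q)
  linear-cong {F} d (++-cong {a} {b} {c} {e} p q) =
    ∼-trans (∼-reflexive (linear-++ F a c))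
      (∼-trans (++-cong (linear-cong d p) (linear-cong d q)) (∼-reflexive (sym (linear-++ F b e))))
  linear-cong {F} d (∼-swap {m , σ} {n , τ}) = begin
    scale m (F σ) ++ scale n (F τ) ++ []  ≡⟨ cong (scale m (F σ) ++_) (++-identityʳ _) ⟩
    scale m (F σ) ++ scale n (F τ)        ≈⟨ ++-comm-∼ (scale m (F σ)) (scale n (F τ)) ⟩
    scale n (F τ) ++ scale m (F σ)        ≡⟨ cong (scale n (F τ) ++_) (++-identityʳ _) ⟨
    scale n (F τ) ++ scale m (F σ) ++ []  ∎
    where open ∼-Reasoning
  linear-cong {F} d (∼-merge {m} {n} {σ} {τ} e) = begin
    scale m (F σ) ++ scale n (F τ) ++ []  ≡⟨ cong (scale m (F σ) ++_) (++-identityʳ _) ⟩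
    scale m (F σ) ++ scale n (F τ)        ≈⟨ ++-congˡ (scale m (F σ)) (scale-cong n (Descends.resp-≗ᶜ d e)) ⟨
    scale m (F σ) ++ scale n (F σ)        ≈⟨ scale-+ m n (F σ) ⟩
    scale (m ℤ.+ n) (F σ)                 ≡⟨ ++-identityʳ _ ⟨
    scale (m ℤ.+ n) (F σ) ++ []           ∎
    where open ∼-Reasoning
  linear-cong {F} d (∼-zero {σ})      = ∼-trans (∼-reflexive (++-identityʳ _)) (scale-0 (F σ))
  linear-cong d (∼-degen {n} deg) =
    ∼-trans (∼-reflexive (++-identityʳ _)) (scale-cong n (Descends.degenerate-null d deg))

  linear-ext : ∀ {F G : RCube X k → RChain Y j} → (∀ σ → F σ ∼ G σ) → ∀ a → linear F a ∼ linear G a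
  linear-ext h []            = ∼-refl
  linear-ext h ((n , σ) ∷ a) = ++-cong (scale-cong n (h σ)) (linear-ext h a)

  linear-null : ∀ {F : RCube X k → RChain Y j} → (∀ σ → F σ ∼ []) → ∀ a → linear F a ∼ []
  linear-null h []            = ∼-refl
  linear-null h ((n , σ) ∷ a) = ++-cong {b = []} (scale-cong n (h σ)) (linear-null h a)

  linear-+ : ∀ (F G : RCube X k → RChain Y j) a →
             linear (λ σ → F σ ++ G σ) a ∼ linear F a ++ linear G a
  linear-+ F G []            = ∼-refl
  linear-+ F G ((n , σ) ∷ a) =
    ∼-trans (++-cong (∼-reflexive (scale-++ n (F σ) (G σ))) (linear-+ F G a))
            (++-interchange (scale n (F σ)) (scale n (G σ)) (linear F a) (linear G a))

  linear-negᶠ : ∀ (F : RCube X k → RChain Y j) a → linear (λ σ → neg (F σ)) a ≡ neg (linear F a)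
  linear-negᶠ F []            = refl
  linear-negᶠ F ((n , σ) ∷ a) = trans (cong₂ _++_ scale-neg-comm (linear-negᶠ F a))
                                      (sym (neg-++ (scale n (F σ)) (linear F a)))
    where
    scale-neg-comm : scale n (neg (F σ)) ≡ neg (scale n (F σ))
    scale-neg-comm = trans (scale-scale n -1ℤ (F σ))
                    (trans (cong (λ z → scale z (F σ)) (ℤP.*-comm n -1ℤ)) (sym (scale-scale -1ℤ n (F σ))))

linear-unit : ∀ {X k} (a : RChain X k) → linear [_]ᶜ a ∼ a
linear-unit []            = ∼-refl
linear-unit ((n , σ) ∷ a) = ++-cong {a = _ ∷ []} (coeff-cong (ℤP.*-identityʳ n)) (linear-unit a)

linear-[]ᶜ : ∀ {X Y k j} (F : RCube X k → RChain Y j) σ → linear F [ σ ]ᶜ ≡ F σ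
linear-[]ᶜ F σ = trans (++-identityʳ _) (scale-1 (F σ))

linear-linear : ∀ {X Y Z k j i} (F : RCube Y j → RChain Z i) (G : RCube X k → RChain Y j) a →
                linear F (linear G a) ≡ linear (λ σ → linear F (G σ)) a
linear-linear F G []            = refl
linear-linear F G ((n , σ) ∷ a) =
  trans (linear-++ F (scale n (G σ)) (linear G a)) (cong₂ _++_ (linear-scale F n (G σ)) (linear-linear F G a))

linear-concatMap : ∀ {X Y k j} {I : Set} (F : RCube X k → RChain Y j) (G : I → RChain X k) L →
                   linear F (concatMap G L) ≡ concatMap (linear F ∘ G) L
linear-concatMap F G []      = refl
linear-concatMap F G (i ∷ L) = trans (linear-++ F (G i) (concatMap G L)) (cong (_ ++_) (linear-concatMap F G L))

module _ {X : RGraph} {k : ℕ} {I : Set} where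

  concatMap-cong-∼ : ∀ {F G : I → RChain X k} → (∀ i → F i ∼ G i) → ∀ L → concatMap F L ∼ concatMap G L
  concatMap-cong-∼ h []      = ∼-refl
  concatMap-cong-∼ h (i ∷ L) = ++-cong (h i) (concatMap-cong-∼ h L)

  concatMap-null : ∀ {F : I → RChain X k} → (∀ i → F i ∼ []) → ∀ L → concatMap F L ∼ []
  concatMap-null h []      = ∼-refl
  concatMap-null h (i ∷ L) = ++-cong {b = []} (h i) (concatMap-null h L)

  neg-concatMap : ∀ (F : I → RChain X k) L → neg (concatMap F L) ≡ concatMap (neg ∘ F) L
  neg-concatMap F []      = refl
  neg-concatMap F (i ∷ L) = trans (neg-++ (F i) (concatMap F L)) (cong (_ ++_) (neg-concatMap F L))

boundary-pair : ∀ {X m} → RCube X (suc m) → Fin (suc m) → RChain X m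
boundary-pair σ i = (sgn (suc (toℕ i)) , facet i false σ) ∷ (- sgn (suc (toℕ i)) , facet i true σ) ∷ []

cubeBoundary : ∀ {X m} → RCube X (suc m) → RChain X m
cubeBoundary {m = m} σ = concatMap (boundary-pair σ) (allFin (suc m))

boundary : ∀ {X m} → RChain X (suc m) → RChain X m
boundary = linear cubeBoundary

cubeBoundary-split : ∀ {X m} (σ : RCube X (suc m)) →
                     cubeBoundary σ ≡ boundary-pair σ fz ++ concatMap (boundary-pair σ ∘ fs) (allFin m)
cubeBoundary-split {m = m} σ =
  cong (boundary-pair σ fz ++_)
    (trans (cong (concatMap (boundary-pair σ)) (sym (map-tabulate id fs))) (concatMap-map (boundary-pair σ) fs (allFin m)))

cubeBoundary-cong : ∀ {X m} {σ τ : RCube X (suc m)} → σ ≗ᶜ τ → cubeBoundary σ ∼ cubeBoundary τ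
cubeBoundary-cong {m = m} e =
  concatMap-cong-∼ (λ i → cube-cong₂ refl refl (λ x → e (insertAt x i false)) (λ x → e (insertAt x i true)))
                   (allFin (suc m))

boundary-++ : ∀ {X m} (a b : RChain X (suc m)) → boundary (a ++ b) ≡ boundary a ++ boundary b
boundary-++ = linear-++ cubeBoundary

boundary-neg : ∀ {X m} (a : RChain X (suc m)) → boundary (neg a) ≡ neg (boundary a)
boundary-neg = linear-neg cubeBoundary

Cycle : ∀ {X k} → RChain X k → Set
Cycle {k = zero}  c = ⊤
Cycle {k = suc m} c = boundary c ∼ []

record RMap (X Y : RGraph) : Set where
  field
    vmap      : Vtx X → Vtx Y
    vmap-near : ∀ {u v} → Near X u v → Near Y (vmap u) (vmap v)
    vmap-same : ∀ {u v} → Same X u v → Same Y (vmap u) (vmap v)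
open RMap public

idᴿ : ∀ {X} → RMap X X
idᴿ = record { vmap = id ; vmap-near = id ; vmap-same = id }

_∘ᴿ_ : ∀ {X Y Z} → RMap Y Z → RMap X Y → RMap X Z
ψ ∘ᴿ φ = record
  { vmap = vmap ψ ∘ vmap φ ; vmap-near = vmap-near ψ ∘ vmap-near φ ; vmap-same = vmap-same ψ ∘ vmap-same φ }

mapCube : ∀ {X Y k} → RMap X Y → RCube X k → RCube Y k
mapCube φ σ = rcube (vmap φ ∘ corner σ) (vmap-near φ ∘ corner-near σ)

push : ∀ {X Y k} → RMap X Y → RChain X k → RChain Y k
push φ = linear ([_]ᶜ ∘ mapCube φ)

mapCube-degenerate : ∀ {X Y k} (φ : RMap X Y) {σ : RCube X k} → IsDegenerate σ → IsDegenerate (mapCube φ σ)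
mapCube-degenerate {k = suc m} φ (i , e) = i , vmap-same φ ∘ e

push-descends : ∀ {X Y k} (φ : RMap X Y) → Descends {X} {Y} {k} ([_]ᶜ ∘ mapCube φ)
push-descends φ = record
  { resp-≗ᶜ = λ e → cube-cong (vmap-same φ ∘ e) ; degenerate-null = ∼-degen ∘ mapCube-degenerate φ }

push-cong : ∀ {X Y k} (φ : RMap X Y) {a b : RChain X k} → a ∼ b → push φ a ∼ push φ b
push-cong φ = linear-cong (push-descends φ)

push-id : ∀ {X k} (c : RChain X k) → push idᴿ c ∼ c
push-id = linear-unit

push-∘ : ∀ {X Y Z k} (ψ : RMap Y Z) (φ : RMap X Y) (c : RChain X k) → push ψ (push φ c) ∼ push (ψ ∘ᴿ φ) c
push-∘ ψ φ c = ∼-trans (∼-reflexive (linear-linear ([_]ᶜ ∘ mapCube ψ) ([_]ᶜ ∘ mapCube φ) c))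
  (linear-ext (λ σ → ∼-trans (∼-reflexive (++-identityʳ _)) (coeff-cong (ℤP.*-identityʳ 1ℤ))) c)

push-ext : ∀ {X Y k} {φ ψ : RMap X Y} → (∀ v → Same Y (vmap φ v) (vmap ψ v)) →
           (c : RChain X k) → push φ c ∼ push ψ c
push-ext h = linear-ext (λ σ → cube-cong {n = 1ℤ} (h ∘ corner σ))

cubeBoundary-mapCube : ∀ {X Y m} (φ : RMap X Y) (σ : RCube X (suc m)) →
                       cubeBoundary (mapCube φ σ) ∼ push φ (cubeBoundary σ)
cubeBoundary-mapCube {Y = Y} {m = m} φ σ =
  ∼-trans (concatMap-cong-∼ {F = boundary-pair (mapCube φ σ)} {G = push φ ∘ boundary-pair σ}
                            (λ i → ∼-sym (cube-cong₂ (ℤP.*-identityʳ _) (ℤP.*-identityʳ _) (λ _ → same-refl Y) (λ _ → same-refl Y)))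
                            (allFin (suc m)))
          (∼-reflexive (sym (linear-concatMap ([_]ᶜ ∘ mapCube φ) (boundary-pair σ) (allFin (suc m)))))

boundary-push : ∀ {X Y m} (φ : RMap X Y) (c : RChain X (suc m)) → boundary (push φ c) ∼ push φ (boundary c)
boundary-push φ c = ∼-trans (∼-reflexive (linear-linear cubeBoundary ([_]ᶜ ∘ mapCube φ) c))
  (∼-trans (linear-ext (λ σ → ∼-trans (∼-reflexive (linear-[]ᶜ cubeBoundary (mapCube φ σ))) (cubeBoundary-mapCube φ σ)) c)
           (∼-reflexive (sym (linear-linear ([_]ᶜ ∘ mapCube φ) cubeBoundary c))))

record Edge (X : RGraph) : Set where
  constructor edge
  field
    src      : Vtx X
    tgt      : Vtx X
    src-near : Near X src tgt
open Edge public

-- A k-cube of the edge graph is a (k+1)-cube of X: a prism over its first coordinate.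
EdgeGraph : RGraph → RGraph
EdgeGraph X = record
  { Vtx        = Edge X
  ; Same       = λ e f → Same X (src e) (src f) × Same X (tgt e) (tgt f)
  ; same-refl  = same-refl X , same-refl X
  ; same-sym   = λ (p , q) → same-sym X p , same-sym X q
  ; same-trans = λ (p , q) (p′ , q′) → same-trans X p p′ , same-trans X q q′
  ; Near       = λ e f → Near X (src e) (src f) × Near X (tgt e) (tgt f)
  ; near-sym   = λ (p , q) → near-sym X p , near-sym X q
  }

module _ {X : RGraph} where

  source target : RMap (EdgeGraph X) X
  source = record { vmap = src ; vmap-near = proj₁ ; vmap-same = proj₁ }
  target = record { vmap = tgt ; vmap-near = proj₂ ; vmap-same = proj₂ }

  prism : ∀ {k} → RCube (EdgeGraph X) k → RCube X (suc k)
  prism {k} ρ = rcube corners near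
    where
    corners : Vec Bool (suc k) → Vtx X
    corners (false ∷ x) = src (corner ρ x)
    corners (true ∷ x)  = tgt (corner ρ x)
    near : ∀ {x y} → QAdj x y → Near X (corners x) (corners y)
    near (here {b = false} {x}) = src-near (corner ρ x)
    near (here {b = true} {x})  = near-sym X (src-near (corner ρ x))
    near (there {b = false} q)  = proj₁ (corner-near ρ q)
    near (there {b = true} q)   = proj₂ (corner-near ρ q)

  prismChain : ∀ {k} → RChain (EdgeGraph X) k → RChain X (suc k)
  prismChain = linear ([_]ᶜ ∘ prism)

  prism-cong : ∀ {k} {ρ ρ′ : RCube (EdgeGraph X) k} → ρ ≗ᶜ ρ′ → prism ρ ≗ᶜ prism ρ′
  prism-cong e (false ∷ x) = proj₁ (e x)
  prism-cong e (true ∷ x)  = proj₂ (e x)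

  prism-degenerate : ∀ {k} {ρ : RCube (EdgeGraph X) k} → IsDegenerate ρ → IsDegenerate (prism ρ)
  prism-degenerate {suc m} (i , e) = fs i , λ { (false ∷ x) → proj₁ (e x) ; (true ∷ x) → proj₂ (e x) }

  prismChain-cong : ∀ {k} {a b : RChain (EdgeGraph X) k} → a ∼ b → prismChain a ∼ prismChain b
  prismChain-cong = linear-cong record
    { resp-≗ᶜ = cube-cong ∘ prism-cong ; degenerate-null = ∼-degen ∘ prism-degenerate }

  prismEnds : ∀ {k} → RCube (EdgeGraph X) k → RChain X k
  prismEnds ρ = (-1ℤ , mapCube source ρ) ∷ (1ℤ , mapCube target ρ) ∷ []

  cubeBoundary-prism₀ : ∀ (ρ : RCube (EdgeGraph X) 0) → cubeBoundary (prism ρ) ∼ prismEnds ρ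
  cubeBoundary-prism₀ ρ = cube-cong₂ refl refl (λ _ → same-refl X) (λ _ → same-refl X)

  -- the facets of a prism transverse to its axis are the prisms over the facets of ρ, with the
  -- opposite sign since their index is shifted by one
  cubeBoundary-prism : ∀ {m} (ρ : RCube (EdgeGraph X) (suc m)) →
                       cubeBoundary (prism ρ) ∼ prismEnds ρ ++ neg (prismChain (cubeBoundary ρ))
  cubeBoundary-prism {m} ρ = ∼-trans (∼-reflexive (cubeBoundary-split (prism ρ)))
    (++-cong (cube-cong₂ refl refl (λ _ → same-refl X) (λ _ → same-refl X))
             (∼-trans (concatMap-cong-∼ transverse (allFin (suc m)))
                      (∼-reflexive (sym (trans (cong neg (linear-concatMap ([_]ᶜ ∘ prism) (boundary-pair ρ) (allFin (suc m))))
                                               (neg-concatMap (prismChain ∘ boundary-pair ρ) (allFin (suc m))))))))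
    where
    facet-prism : ∀ j b → facet (fs j) b (prism ρ) ≗ᶜ prism (facet j b ρ)
    facet-prism j b (false ∷ x) = same-refl X
    facet-prism j b (true ∷ x)  = same-refl X
    neg-unit : ∀ s → -1ℤ ℤ.* (s ℤ.* 1ℤ) ≡ - s
    neg-unit s = trans (cong (-1ℤ ℤ.*_) (ℤP.*-identityʳ s)) (ℤP.-1*i≡-i s)
    transverse : ∀ j → boundary-pair (prism ρ) (fs j) ∼ neg (prismChain (boundary-pair ρ j))
    transverse j = cube-cong₂ (sym (neg-unit _)) (sym (neg-unit _)) (facet-prism j false) (facet-prism j true)

unprism : ∀ {X m} → RCube X (suc m) → RCube (EdgeGraph X) m
unprism σ = rcube (λ x → edge (corner σ (false ∷ x)) (corner σ (true ∷ x)) (corner-near σ here))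
                  (λ q → corner-near σ (there q) , corner-near σ (there q))

prism-unprism : ∀ {X m} (σ : RCube X (suc m)) → σ ≗ᶜ prism (unprism σ)
prism-unprism {X} σ (false ∷ x) = same-refl X
prism-unprism {X} σ (true ∷ x)  = same-refl X

cubeBoundary-unprism : ∀ {X m} (σ : RCube X (suc m)) → cubeBoundary σ ∼ cubeBoundary (prism (unprism σ))
cubeBoundary-unprism σ = cubeBoundary-cong {σ = σ} {τ = prism (unprism σ)} (prism-unprism σ)

cubeBoundary-prism-flat : ∀ {X m} (ρ : RCube (EdgeGraph X) m) →
                          mapCube source ρ ≗ᶜ mapCube target ρ → cubeBoundary (prism ρ) ∼ []
cubeBoundary-prism-flat {m = zero}  ρ flat = ∼-trans (cubeBoundary-prism₀ ρ) (cancel-pair flat refl)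
cubeBoundary-prism-flat {m = suc m} ρ flat = ∼-trans (cubeBoundary-prism ρ)
  (++-cong {b = []} (cancel-pair flat refl)
    (neg-cong (∼-trans (∼-reflexive (linear-concatMap ([_]ᶜ ∘ prism) (boundary-pair ρ) (allFin (suc m))))
                       (concatMap-null facets-flat (allFin (suc m))))))
  where
  facets-flat : ∀ j → prismChain (boundary-pair ρ j) ∼ []
  facets-flat j = ++-cong {b = []} (∼-degen (fz , flat ∘ λ x → insertAt x j false))
                    (++-cong {b = []} (∼-degen (fz , flat ∘ λ x → insertAt x j true)) ∼-refl)

-- Seen as a prism, σ degenerate along the axis is a flat prism; degenerate in another direction,
-- it is the prism over a degenerate cube of the edge graph.
cubeBoundary-degenerate : ∀ {X m} (σ : RCube X (suc m)) → IsDegenerate σ → cubeBoundary σ ∼ []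
cubeBoundary-degenerate σ (fz , e) =
  ∼-trans (cubeBoundary-unprism σ) (cubeBoundary-prism-flat (unprism σ) e)
cubeBoundary-degenerate {m = suc m} σ (fs i , e) =
  ∼-trans (cubeBoundary-unprism σ) (∼-trans (cubeBoundary-prism (unprism σ))
    (++-cong {b = []} ends-degenerate
      (neg-cong (prismChain-cong (cubeBoundary-degenerate (unprism σ) (i , λ x → e (false ∷ x) , e (true ∷ x)))))))
  where
  ends-degenerate : prismEnds (unprism σ) ∼ []
  ends-degenerate = ++-cong {a = _ ∷ []} {b = []} (∼-degen (i , λ x → e (false ∷ x)))
                      (++-cong {a = _ ∷ []} {b = []} (∼-degen (i , λ x → e (true ∷ x))) ∼-refl)

boundary-cong : ∀ {X m} {a b : RChain X (suc m)} → a ∼ b → boundary a ∼ boundary b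
boundary-cong = linear-cong record
  { resp-≗ᶜ = λ {σ} {τ} → cubeBoundary-cong {σ = σ} {τ = τ} ; degenerate-null = λ {σ} → cubeBoundary-degenerate σ }

module _ {X : RGraph} where

  boundary-prismChain : ∀ {m} (c : RChain (EdgeGraph X) (suc m)) →
    boundary (prismChain c) ∼ (neg (push source c) ++ push target c) ++ neg (prismChain (boundary c))
  boundary-prismChain c = begin
    boundary (prismChain c)
      ≡⟨ linear-linear cubeBoundary ([_]ᶜ ∘ prism) c ⟩
    linear (λ ρ → linear cubeBoundary [ prism ρ ]ᶜ) c
      ≈⟨ linear-ext (λ ρ → ∼-trans (∼-reflexive (linear-[]ᶜ cubeBoundary (prism ρ))) (cubeBoundary-prism ρ)) c ⟩
    linear (λ ρ → (neg [ mapCube source ρ ]ᶜ ++ [ mapCube target ρ ]ᶜ) ++ neg (prismChain (cubeBoundary ρ))) c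
      ≈⟨ linear-+ (λ ρ → neg [ mapCube source ρ ]ᶜ ++ [ mapCube target ρ ]ᶜ) (λ ρ → neg (prismChain (cubeBoundary ρ))) c ⟩
    linear (λ ρ → neg [ mapCube source ρ ]ᶜ ++ [ mapCube target ρ ]ᶜ) c ++ linear (λ ρ → neg (prismChain (cubeBoundary ρ))) c
      ≈⟨ ++-cong (linear-+ (λ ρ → neg [ mapCube source ρ ]ᶜ) ([_]ᶜ ∘ mapCube target) c) ∼-refl ⟩
    (linear (λ ρ → neg [ mapCube source ρ ]ᶜ) c ++ push target c) ++ linear (λ ρ → neg (prismChain (cubeBoundary ρ))) c
      ≡⟨ cong₂ (λ a b → (a ++ push target c) ++ b) (linear-negᶠ ([_]ᶜ ∘ mapCube source) c)
               (trans (linear-negᶠ (prismChain ∘ cubeBoundary) c) (cong neg (sym (linear-linear ([_]ᶜ ∘ prism) cubeBoundary c)))) ⟩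
    (neg (push source c) ++ push target c) ++ neg (prismChain (boundary c))
      ∎
    where open ∼-Reasoning

  boundary-prismChain₀ : ∀ (c : RChain (EdgeGraph X) 0) →
                         boundary (prismChain c) ∼ neg (push source c) ++ push target c
  boundary-prismChain₀ c = begin
    boundary (prismChain c)
      ≡⟨ linear-linear cubeBoundary ([_]ᶜ ∘ prism) c ⟩
    linear (λ ρ → linear cubeBoundary [ prism ρ ]ᶜ) c
      ≈⟨ linear-ext (λ ρ → ∼-trans (∼-reflexive (linear-[]ᶜ cubeBoundary (prism ρ))) (cubeBoundary-prism₀ ρ)) c ⟩
    linear (λ ρ → neg [ mapCube source ρ ]ᶜ ++ [ mapCube target ρ ]ᶜ) c
      ≈⟨ linear-+ (λ ρ → neg [ mapCube source ρ ]ᶜ) ([_]ᶜ ∘ mapCube target) c ⟩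
    linear (λ ρ → neg [ mapCube source ρ ]ᶜ) c ++ push target c
      ≡⟨ cong (_++ push target c) (linear-negᶠ ([_]ᶜ ∘ mapCube source) c) ⟩
    neg (push source c) ++ push target c
      ∎
    where open ∼-Reasoning

  boundary-prismChain-cycle : ∀ {m} (c : RChain (EdgeGraph X) m) → Cycle c →
                              boundary (prismChain c) ∼ neg (push source c) ++ push target c
  boundary-prismChain-cycle {zero}  c _ = boundary-prismChain₀ c
  boundary-prismChain-cycle {suc m} c z = ∼-trans (boundary-prismChain c)
    (∼-trans (++-congˡ (neg (push source c) ++ push target c) (neg-cong (prismChain-cong z)))
             (∼-reflexive (++-identityʳ _)))

  boundary-prismEnds : ∀ {m} (ρ : RCube (EdgeGraph X) (suc m)) →
    boundary (prismEnds ρ) ∼ neg (push source (cubeBoundary ρ)) ++ push target (cubeBoundary ρ)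
  boundary-prismEnds ρ =
    ++-cong (neg-cong (cubeBoundary-mapCube source ρ))
            (∼-trans (∼-reflexive (linear-[]ᶜ cubeBoundary (mapCube target ρ))) (cubeBoundary-mapCube target ρ))

cubeBoundary-cycle : ∀ {X m} (σ : RCube X (suc m)) → Cycle (cubeBoundary σ)
cubeBoundary-cycle {m = zero}  σ = tt
cubeBoundary-cycle {m = suc m} σ = begin
    boundary (cubeBoundary σ)
      ≈⟨ boundary-cong (cubeBoundary-unprism σ) ⟩
    boundary (cubeBoundary (prism ρ))
      ≈⟨ boundary-cong (cubeBoundary-prism ρ) ⟩
    boundary (prismEnds ρ ++ neg (prismChain ∂ρ))
      ≡⟨ trans (boundary-++ (prismEnds ρ) (neg (prismChain ∂ρ))) (cong (boundary (prismEnds ρ) ++_) (boundary-neg (prismChain ∂ρ))) ⟩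
    boundary (prismEnds ρ) ++ neg (boundary (prismChain ∂ρ))
      ≈⟨ ++-cong (boundary-prismEnds ρ) (neg-cong (boundary-prismChain-cycle ∂ρ (cubeBoundary-cycle ρ))) ⟩
    ends ++ neg ends
      ≈⟨ neg-inverseʳ ends ⟩
    [] ∎
  where
  open ∼-Reasoning
  ρ = unprism σ
  ∂ρ = cubeBoundary ρ
  ends = neg (push source ∂ρ) ++ push target ∂ρ

boundary² : ∀ {X m} (c : RChain X (suc (suc m))) → boundary (boundary c) ∼ []
boundary² c = ∼-trans (∼-reflexive (linear-linear cubeBoundary cubeBoundary c)) (linear-null cubeBoundary-cycle c)

IsBoundary : ∀ {X k} → RChain X k → Set
IsBoundary {X} {k} c = Σ (RChain X (suc k)) λ d → c ∼ boundary d

push-cycle : ∀ {X Y k} (φ : RMap X Y) {c : RChain X k} → Cycle c → Cycle (push φ c)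
push-cycle {k = zero}  φ     _ = tt
push-cycle {k = suc m} φ {c} z = ∼-trans (boundary-push φ c) (push-cong φ z)

push-isBoundary : ∀ {X Y k} (φ : RMap X Y) {c : RChain X k} → IsBoundary c → IsBoundary (push φ c)
push-isBoundary φ (d , c∼∂d) = push φ d , ∼-trans (push-cong φ c∼∂d) (∼-sym (boundary-push φ d))

module _ {X Y : RGraph} (f h : RMap X Y) (near : ∀ v → Near Y (vmap f v) (vmap h v)) where

  homotopy : RMap X (EdgeGraph Y)
  homotopy = record
    { vmap      = λ v → edge (vmap f v) (vmap h v) (near v)
    ; vmap-near = λ r → vmap-near f r , vmap-near h r
    ; vmap-same = λ e → vmap-same f e , vmap-same h e }

  push-near : ∀ {k} (c : RChain X k) → Cycle c → push h c ∼ push f c ++ boundary (prismChain (push homotopy c))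
  push-near c z = ∼-sym (begin
    push f c ++ boundary (prismChain (push homotopy c))
      ≈⟨ ++-congˡ (push f c) (boundary-prismChain-cycle (push homotopy c) (push-cycle homotopy z)) ⟩
    push f c ++ (neg (push source (push homotopy c)) ++ push target (push homotopy c))
      ≈⟨ ++-congˡ (push f c) (++-cong (neg-cong (push-∘ source homotopy c)) (push-∘ target homotopy c)) ⟩
    push f c ++ (neg (push f c) ++ push h c)
      ≡⟨ ++-assoc (push f c) (neg (push f c)) (push h c) ⟨
    (push f c ++ neg (push f c)) ++ push h c
      ≈⟨ ++-congʳ (push h c) (neg-inverseʳ (push f c)) ⟩
    push h c ∎)
    where open ∼-Reasoning

_^ᴿ_ : ∀ {X} → RMap X X → ℕ → RMap X X
d ^ᴿ zero  = idᴿ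
d ^ᴿ suc n = (d ^ᴿ n) ∘ᴿ d

module _ {X : RGraph} (d : RMap X X) (d-near : ∀ v → Near X (vmap d v) v) where

  push-iterate-homologous : ∀ {k} n (c : RChain X k) → Cycle c → Σ (RChain X (suc k)) λ e → c ∼ push (d ^ᴿ n) c ++ boundary e
  push-iterate-homologous zero c z = [] , ∼-trans (∼-sym (push-id c)) (∼-reflexive (sym (++-identityʳ _)))
  push-iterate-homologous (suc n) c z with push-iterate-homologous n (push d c) (push-cycle d z)
  ... | e , dc∼ = e ++ h , (begin
    c                                                ≈⟨ push-id c ⟨
    push idᴿ c                                       ≈⟨ push-near d idᴿ d-near c z ⟩
    push d c ++ boundary h                           ≈⟨ ++-congʳ (boundary h) dc∼ ⟩
    (push (d ^ᴿ n) (push d c) ++ boundary e) ++ boundary h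
      ≡⟨ ++-assoc (push (d ^ᴿ n) (push d c)) (boundary e) (boundary h) ⟩
    push (d ^ᴿ n) (push d c) ++ boundary e ++ boundary h
      ≈⟨ ++-cong (push-∘ (d ^ᴿ n) d c) (∼-reflexive (sym (boundary-++ e h))) ⟩
    push (d ^ᴿ suc n) c ++ boundary (e ++ h)         ∎)
    where
    open ∼-Reasoning
    h = prismChain (push (homotopy d idᴿ d-near) c)

augmentation : ∀ {X} → RChain X 0 → ℤ
augmentation []            = 0ℤ
augmentation ((n , σ) ∷ c) = n ℤ.+ augmentation c

augmentation-++ : ∀ {X} (a b : RChain X 0) → augmentation (a ++ b) ≡ augmentation a ℤ.+ augmentation b
augmentation-++ []            b = sym (ℤP.+-identityˡ _)
augmentation-++ ((n , σ) ∷ a) b =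
  trans (cong (λ z → n ℤ.+ z) (augmentation-++ a b)) (sym (ℤP.+-assoc n _ _))

augmentation-cong : ∀ {X} {a b : RChain X 0} → a ∼ b → augmentation a ≡ augmentation b
augmentation-cong ∼-refl        = refl
augmentation-cong (∼-sym p)     = sym (augmentation-cong p)
augmentation-cong (∼-trans p q) = trans (augmentation-cong p) (augmentation-cong q)
augmentation-cong (++-cong {a} {b} {c} {d} p q) =
  trans (augmentation-++ a c)
    (trans (cong₂ ℤ._+_ (augmentation-cong p) (augmentation-cong q)) (sym (augmentation-++ b d)))
augmentation-cong (∼-swap {m , _} {n , _}) =
  trans (sym (ℤP.+-assoc m n 0ℤ)) (trans (cong (ℤ._+ 0ℤ) (ℤP.+-comm m n)) (ℤP.+-assoc n m 0ℤ))
augmentation-cong (∼-merge {m} {n} e) = sym (ℤP.+-assoc m n 0ℤ)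
augmentation-cong ∼-zero        = refl
augmentation-cong (∼-degen ())

augmentation-scale : ∀ {X} n (a : RChain X 0) → augmentation (scale n a) ≡ n ℤ.* augmentation a
augmentation-scale n []            = sym (ℤP.*-zeroʳ n)
augmentation-scale n ((m , σ) ∷ a) =
  trans (cong (λ z → n ℤ.* m ℤ.+ z) (augmentation-scale n a)) (sym (ℤP.*-distribˡ-+ n m _))

augmentation-boundary : ∀ {X} (c : RChain X 1) → augmentation (boundary c) ≡ 0ℤ
augmentation-boundary []            = refl
augmentation-boundary ((n , σ) ∷ c) =
  trans (augmentation-++ (scale n (cubeBoundary σ)) (boundary c))
    (cong₂ ℤ._+_ (trans (augmentation-scale n (cubeBoundary σ)) (ℤP.*-zeroʳ n)) (augmentation-boundary c))

augmentation-push : ∀ {X Y} (φ : RMap X Y) (c : RChain X 0) → augmentation (push φ c) ≡ augmentation c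
augmentation-push φ []            = refl
augmentation-push φ ((n , σ) ∷ c) = cong₂ ℤ._+_ (ℤP.*-identityʳ n) (augmentation-push φ c)

ReducedCycle : ∀ {X k} → RChain X k → Set
ReducedCycle {k = zero}  c = augmentation c ≡ 0ℤ
ReducedCycle {k = suc m} c = boundary c ∼ []

ReducedAcyclic : RGraph → ℕ → Set
ReducedAcyclic X k = ∀ (c : RChain X k) → ReducedCycle c → IsBoundary c

reducedCycle⇒cycle : ∀ {X k} {c : RChain X k} → ReducedCycle c → Cycle c
reducedCycle⇒cycle {k = zero}  _ = tt
reducedCycle⇒cycle {k = suc m} z = z

reducedCycle-cong : ∀ {X k} {a b : RChain X k} → a ∼ b → ReducedCycle a → ReducedCycle b
reducedCycle-cong {k = zero}  a∼b z = trans (sym (augmentation-cong a∼b)) z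
reducedCycle-cong {k = suc m} a∼b z = ∼-trans (boundary-cong (∼-sym a∼b)) z

boundary-reducedCycle : ∀ {X k} (c : RChain X (suc k)) → ReducedCycle (boundary c)
boundary-reducedCycle {k = zero}  c = augmentation-boundary c
boundary-reducedCycle {k = suc m} c = boundary² c

push-reducedCycle : ∀ {X Y k} (φ : RMap X Y) {c : RChain X k} → ReducedCycle c → ReducedCycle (push φ c)
push-reducedCycle {k = zero}  φ {c} z = trans (augmentation-push φ c) z
push-reducedCycle {k = suc m} φ {c} z = push-cycle φ {c} z

retract-reducedAcyclic : ∀ {X Y k} (d : RMap X X) → (∀ v → Near X (vmap d v) v) → ∀ n (r : RMap X Y) (s : RMap Y X) →
                         (∀ v → Same X (vmap (d ^ᴿ n) v) (vmap (s ∘ᴿ r) v)) → ReducedAcyclic Y k → ReducedAcyclic X k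
retract-reducedAcyclic d d-near n r s factors acyclic c z
  with push-iterate-homologous d d-near n c (reducedCycle⇒cycle {c = c} z) | acyclic (push r c) (push-reducedCycle r z)
... | e , c∼ | u , rc∼ = push s u ++ e , (begin
  c                                          ≈⟨ c∼ ⟩
  push (d ^ᴿ n) c ++ boundary e              ≈⟨ ++-congʳ (boundary e) (push-ext {φ = d ^ᴿ n} {ψ = s ∘ᴿ r} factors c) ⟩
  push (s ∘ᴿ r) c ++ boundary e              ≈⟨ ++-congʳ (boundary e) (push-∘ s r c) ⟨
  push s (push r c) ++ boundary e            ≈⟨ ++-congʳ (boundary e) (push-cong s rc∼) ⟩
  push s (boundary u) ++ boundary e          ≈⟨ ++-congʳ (boundary e) (boundary-push s u) ⟨
  boundary (push s u) ++ boundary e          ≡⟨ boundary-++ (push s u) e ⟨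
  boundary (push s u ++ e)                   ∎)
  where open ∼-Reasoning

Point : RGraph
Point = record
  { Vtx = ⊤ ; Same = λ _ _ → ⊤ ; same-refl = tt ; same-sym = λ _ → tt ; same-trans = λ _ _ → tt
  ; Near = λ _ _ → ⊤ ; near-sym = λ _ → tt }

point-reducedAcyclic : ∀ m → ReducedAcyclic Point (suc m)
point-reducedAcyclic m c _ = [] , null c
  where
  null : (c : RChain Point (suc m)) → c ∼ []
  null []      = ∼-refl
  null (x ∷ c) = ++-cong {a = x ∷ []} {b = []} (∼-degen (fz , λ _ → tt)) (null c)

Every : ∀ {X k} → (RCube X k → Set) → RChain X k → Set
Every P = All (P ∘ proj₂)

Every-scale : ∀ {X k} {P : RCube X k → Set} n {c} → Every P c → Every P (scale n c)
Every-scale n = map⁺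

Every-linear : ∀ {X Y k j} {P : RCube X k → Set} {Q : RCube Y j → Set} (F : RCube X k → RChain Y j) →
               (∀ σ → P σ → Every Q (F σ)) → ∀ {c} → Every P c → Every Q (linear F c)
Every-linear F h []                     = []
Every-linear F h {(n , σ) ∷ c} (p ∷ ps) = ++⁺ (Every-scale n (h σ p)) (Every-linear F h ps)

linear-ext-Every : ∀ {X Y k j} {P : RCube X k → Set} {F G : RCube X k → RChain Y j} →
                   (∀ σ → P σ → F σ ∼ G σ) → ∀ {c} → Every P c → linear F c ∼ linear G c
linear-ext-Every h []                     = ∼-refl
linear-ext-Every h {(n , σ) ∷ c} (p ∷ ps) = ++-cong (scale-cong n (h σ p)) (linear-ext-Every h ps)

AllCorners : ∀ {X k} → (Vtx X → Set) → RCube X k → Set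
AllCorners Q σ = ∀ x → Q (corner σ x)

Every-boundary : ∀ {X m} {Q : Vtx X → Set} {c : RChain X (suc m)} →
                 Every (AllCorners Q) c → Every (AllCorners Q) (boundary c)
Every-boundary {X} {m} {Q} = Every-linear cubeBoundary λ σ q →
  facets {σ} (allFin (suc m)) λ i → (q ∘ λ x → insertAt x i false) ∷ (q ∘ λ x → insertAt x i true) ∷ []
  where
  facets : ∀ {σ : RCube X (suc m)} L → (∀ i → Every (AllCorners Q) (boundary-pair σ i)) →
           Every (AllCorners Q) (concatMap (boundary-pair σ) L)
  facets []      h = []
  facets {σ} (i ∷ L) h = ++⁺ (h i) (facets {σ} L h)

all-corners? : ∀ {k} (p : Vec Bool k → Bool) → Dec (∀ x → T (p x))
all-corners? {zero} p with T? (p [])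
... | yes q = yes λ { [] → q }
... | no ¬q = no λ f → ¬q (f [])
all-corners? {suc k} p with all-corners? (p ∘ (false ∷_)) | all-corners? (p ∘ (true ∷_))
... | yes q | yes r = yes λ { (false ∷ x) → q x ; (true ∷ x) → r x }
... | no ¬q | _     = no λ f → ¬q (f ∘ (false ∷_))
... | yes _ | no ¬r = no λ f → ¬r (f ∘ (true ∷_))

module Induced (X : RGraph) (ok : Vtx X → Bool) (ok-resp : ∀ {u v} → Same X u v → ok u ≡ ok v) where

  Sub : RGraph
  Sub = record
    { Vtx = Σ (Vtx X) (T ∘ ok)
    ; Same = λ u v → Same X (proj₁ u) (proj₁ v)
    ; same-refl = same-refl X ; same-sym = same-sym X ; same-trans = same-trans X
    ; Near = λ u v → Near X (proj₁ u) (proj₁ v)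
    ; near-sym = near-sym X }

  incl : RMap Sub X
  incl = record { vmap = proj₁ ; vmap-near = id ; vmap-same = id }

  Inside : ∀ {k} → RCube X k → Set
  Inside = AllCorners (T ∘ ok)

  restrictCube : ∀ {k} (σ : RCube X k) → Inside σ → RCube Sub k
  restrictCube σ q = rcube (λ x → corner σ x , q x) (corner-near σ)

  restrict₁ : ∀ {k} → RCube X k → RChain Sub k
  restrict₁ σ with all-corners? (ok ∘ corner σ)
  ... | yes q = [ restrictCube σ q ]ᶜ
  ... | no _  = []

  restrict₁-inside : ∀ {k} (σ : RCube X k) (q : Inside σ) → restrict₁ σ ∼ [ restrictCube σ q ]ᶜ
  restrict₁-inside σ q with all-corners? (ok ∘ corner σ)
  ... | yes _ = cube-cong (λ _ → same-refl X)
  ... | no ¬q = ⊥-elim (¬q q)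

  restrict₁-descends : ∀ {k} → Descends {X} {Sub} {k} restrict₁
  restrict₁-descends = record { resp-≗ᶜ = same-restrict₁ ; degenerate-null = degenerate }
    where
    same-restrict₁ : ∀ {k} {σ τ : RCube X k} → σ ≗ᶜ τ → restrict₁ σ ∼ restrict₁ τ
    same-restrict₁ {σ = σ} {τ} e with all-corners? (ok ∘ corner σ) | all-corners? (ok ∘ corner τ)
    ... | yes _ | yes _ = cube-cong e
    ... | no _  | no _  = ∼-refl
    ... | yes q | no ¬r = ⊥-elim (¬r λ x → subst T (ok-resp (e x)) (q x))
    ... | no ¬q | yes r = ⊥-elim (¬q λ x → subst T (sym (ok-resp (e x))) (r x))
    degenerate : ∀ {k} {σ : RCube X k} → IsDegenerate σ → restrict₁ σ ∼ []
    degenerate {suc m} {σ} (i , e) with all-corners? (ok ∘ corner σ)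
    ... | yes _ = ∼-degen (i , e)
    ... | no _  = ∼-refl

  restrict : ∀ {k} → RChain X k → RChain Sub k
  restrict = linear restrict₁

  restrict-cong : ∀ {k} {a b : RChain X k} → a ∼ b → restrict a ∼ restrict b
  restrict-cong = linear-cong restrict₁-descends

  keep : ∀ {k} → RChain X k → RChain X k
  keep c = push incl (restrict c)

  keep-inside : ∀ {k} {c : RChain X k} → Every Inside c → keep c ∼ c
  keep-inside {c = c} ins = begin
    push incl (restrict c)                  ≡⟨ linear-linear ([_]ᶜ ∘ mapCube incl) restrict₁ c ⟩
    linear (push incl ∘ restrict₁) c        ≈⟨ linear-ext-Every restricted-inside ins ⟩
    linear [_]ᶜ c                           ≈⟨ linear-unit c ⟩
    c                                       ∎
    where
    open ∼-Reasoning
    restricted-inside : ∀ σ → Inside σ → push incl (restrict₁ σ) ∼ [ σ ]ᶜ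
    restricted-inside σ q = ∼-trans (push-cong incl (restrict₁-inside σ q)) (cube-cong (λ _ → same-refl X))

  keep-Every : ∀ {k} {P : RCube X k → Set} {c : RChain X k} → Every P c → Every P (keep c)
  keep-Every {P = P} = Every-linear ([_]ᶜ ∘ mapCube incl) (λ _ p → p ∷ []) ∘ Every-linear restrict₁ restricted
    where
    restricted : ∀ σ → P σ → Every (P ∘ mapCube incl) (restrict₁ σ)
    restricted σ p with all-corners? (ok ∘ corner σ)
    ... | yes _ = p ∷ []
    ... | no _  = []

  Every-Inside-push : ∀ {k} (c : RChain Sub k) → Every Inside (push incl c)
  Every-Inside-push c = Every-linear {P = λ _ → ⊤} ([_]ᶜ ∘ mapCube incl) (λ σ _ → (proj₂ ∘ corner σ) ∷ [])
                                     (All.universal (λ _ → tt) c)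

  Every-Inside-keep : ∀ {k} (c : RChain X k) → Every Inside (keep c)
  Every-Inside-keep c = Every-Inside-push (restrict c)

  boundary-restrict : ∀ {m} {c : RChain X (suc m)} → Every Inside c → boundary (restrict c) ∼ restrict (boundary c)
  boundary-restrict {m} {c} ins = begin
    boundary (restrict c)                   ≡⟨ linear-linear cubeBoundary restrict₁ c ⟩
    linear (boundary ∘ restrict₁) c         ≈⟨ linear-ext-Every per-cube ins ⟩
    linear (restrict ∘ cubeBoundary) c      ≡⟨ linear-linear restrict₁ cubeBoundary c ⟨
    restrict (boundary c)                   ∎
    where
    open ∼-Reasoning
    restrict-pair : ∀ σ (q : Inside σ) i → boundary-pair (restrictCube σ q) i ∼ restrict (boundary-pair σ i)
    restrict-pair σ q i = ∼-sym (++-cong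
      (∼-trans (scale-cong (sgn (suc (toℕ i))) (restrict₁-inside (facet i false σ) (q ∘ λ x → insertAt x i false)))
               (coeff-cong (ℤP.*-identityʳ _)))
      (∼-trans (∼-reflexive (++-identityʳ _))
        (∼-trans (scale-cong (- sgn (suc (toℕ i))) (restrict₁-inside (facet i true σ) (q ∘ λ x → insertAt x i true)))
                 (coeff-cong (ℤP.*-identityʳ _)))))
    per-cube : ∀ σ → Inside σ → boundary (restrict₁ σ) ∼ restrict (cubeBoundary σ)
    per-cube σ q = begin
      boundary (restrict₁ σ)                                ≈⟨ boundary-cong (restrict₁-inside σ q) ⟩
      boundary [ restrictCube σ q ]ᶜ                        ≡⟨ linear-[]ᶜ cubeBoundary (restrictCube σ q) ⟩
      cubeBoundary (restrictCube σ q)                       ≈⟨ concatMap-cong-∼ (restrict-pair σ q) (allFin (suc m)) ⟩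
      concatMap (restrict ∘ boundary-pair σ) (allFin (suc m)) ≡⟨ linear-concatMap restrict₁ (boundary-pair σ) (allFin (suc m)) ⟨
      restrict (cubeBoundary σ)                             ∎

  restrict-reducedCycle : ∀ {k} {c : RChain X k} → Every Inside c → ReducedCycle c → ReducedCycle (restrict c)
  restrict-reducedCycle {zero}  {c} ins z =
    trans (sym (augmentation-push incl (restrict c))) (trans (augmentation-cong (keep-inside ins)) z)
  restrict-reducedCycle {suc m}     ins z = ∼-trans (boundary-restrict ins) (restrict-cong z)

  bounds-inside : ∀ {k} {c : RChain X k} → Every Inside c → IsBoundary (restrict c) →
                  Σ (RChain X (suc k)) λ e → Every Inside e × c ∼ boundary e
  bounds-inside ins (d , rc∼) =
    push incl d , Every-Inside-push d ,
    ∼-trans (∼-sym (keep-inside ins)) (∼-trans (push-cong incl rc∼) (∼-sym (boundary-push incl d)))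

  discard₁ : ∀ {k} → RCube X k → RChain X k
  discard₁ σ with all-corners? (ok ∘ corner σ)
  ... | yes _ = []
  ... | no _  = [ σ ]ᶜ

  discard : ∀ {k} → RChain X k → RChain X k
  discard = linear discard₁

  keep-discard : ∀ {k} (c : RChain X k) → c ∼ keep c ++ discard c
  keep-discard c = begin
    c                                                 ≈⟨ linear-unit c ⟨
    linear [_]ᶜ c                                     ≈⟨ linear-ext split₁ c ⟩
    linear (λ σ → push incl (restrict₁ σ) ++ discard₁ σ) c ≈⟨ linear-+ (push incl ∘ restrict₁) discard₁ c ⟩
    linear (push incl ∘ restrict₁) c ++ discard c     ≡⟨ cong (_++ discard c) (linear-linear ([_]ᶜ ∘ mapCube incl) restrict₁ c) ⟨
    keep c ++ discard c                               ∎
    where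
    open ∼-Reasoning
    split₁ : ∀ σ → [ σ ]ᶜ ∼ push incl (restrict₁ σ) ++ discard₁ σ
    split₁ σ with all-corners? (ok ∘ corner σ)
    ... | yes _ = cube-cong (λ _ → same-refl X)
    ... | no _  = ∼-refl

  discard-outside : ∀ {k} (c : RChain X k) → Every (¬_ ∘ Inside) (discard c)
  discard-outside c = Every-linear {P = λ _ → ⊤} discard₁ outside (All.universal (λ _ → tt) c)
    where
    outside : ∀ σ → ⊤ → Every (¬_ ∘ Inside) (discard₁ σ)
    outside σ _ with all-corners? (ok ∘ corner σ)
    ... | yes _ = []
    ... | no ¬q = ¬q ∷ []

toRGraph : Graph → RGraph
toRGraph G = record
  { Vtx = V G ; Same = _≡_ ; same-refl = refl ; same-sym = sym ; same-trans = trans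
  ; Near = λ u v → u ≡ v ⊎ E G u v
  ; near-sym = λ { (inj₁ e) → inj₁ (sym e) ; (inj₂ e) → inj₂ (E-sym G e) } }

module _ (G : Graph) where
  private
    X = toRGraph G

  vertexCube : V G → RCube X 0
  vertexCube v = rcube (λ _ → v) (λ ())

  edgeCube : ∀ {u w} → E G u w → RCube X 1
  edgeCube {u} {w} e = rcube ends near
    where
    ends : Vec Bool 1 → V G
    ends (false ∷ []) = u
    ends (true ∷ [])  = w
    near : ∀ {x y} → QAdj x y → Near X (ends x) (ends y)
    near (here {b = false} {[]}) = inj₂ e
    near (here {b = true} {[]})  = inj₂ (E-sym G e)

  walkChain : ∀ {u w} → Star (E G) u w → RChain X 1
  walkChain ε       = []
  walkChain (e ◅ p) = [ edgeCube e ]ᶜ ++ walkChain p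

  boundary-walkChain : ∀ {u w} (p : Star (E G) u w) → boundary (walkChain p) ∼ neg [ vertexCube u ]ᶜ ++ [ vertexCube w ]ᶜ
  boundary-walkChain ε = ∼-sym (cancel-pair (λ _ → refl) refl)
  boundary-walkChain (_◅_ {j = j} e p) =
    ∼-trans (++-cong {a = _ ∷ _ ∷ []} (cube-cong₂ refl refl (λ { [] → refl }) (λ { [] → refl })) (boundary-walkChain p))
            (∷-cong (++-cong {a = (1ℤ , vertexCube j) ∷ (-1ℤ , vertexCube j) ∷ []} {b = []}
                             (cancel-pair (λ _ → refl) refl) ∼-refl))

  -- Each point is homologous to the base point through a walk, and the base point drops out
  -- of a chain with augmentation zero.
  connected⇒reducedAcyclic₀ : Connected G → ReducedAcyclic X 0
  connected⇒reducedAcyclic₀ (v₀ , walk) c aug≡0 = linear walkFrom c , ∼-sym (begin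
    boundary (linear walkFrom c)                              ≡⟨ linear-linear cubeBoundary walkFrom c ⟩
    linear (boundary ∘ walkFrom) c                            ≈⟨ linear-ext boundary-walkFrom c ⟩
    linear (λ σ → neg [ vertexCube v₀ ]ᶜ ++ [ σ ]ᶜ) c         ≈⟨ linear-+ (λ _ → neg [ vertexCube v₀ ]ᶜ) [_]ᶜ c ⟩
    linear (λ _ → neg [ vertexCube v₀ ]ᶜ) c ++ linear [_]ᶜ c  ≡⟨ cong (_++ linear [_]ᶜ c) (linear-negᶠ (λ _ → [ vertexCube v₀ ]ᶜ) c) ⟩
    neg (linear (λ _ → [ vertexCube v₀ ]ᶜ) c) ++ linear [_]ᶜ c ≈⟨ ++-cong (neg-cong (based c)) (linear-unit c) ⟩
    neg ((augmentation c , vertexCube v₀) ∷ []) ++ c          ≈⟨ ++-congʳ c (neg-cong (∼-trans (coeff-cong aug≡0) ∼-zero)) ⟩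
    c                                                         ∎)
    where
    open ∼-Reasoning
    walkFrom : RCube X 0 → RChain X 1
    walkFrom σ = walkChain (walk v₀ (corner σ []))
    boundary-walkFrom : ∀ σ → boundary (walkFrom σ) ∼ neg [ vertexCube v₀ ]ᶜ ++ [ σ ]ᶜ
    boundary-walkFrom σ = ∼-trans (boundary-walkChain (walk v₀ (corner σ [])))
                                  (++-congˡ (neg [ vertexCube v₀ ]ᶜ) (cube-cong λ { [] → refl }))
    based : ∀ c → linear (λ _ → [ vertexCube v₀ ]ᶜ) c ∼ (augmentation c , vertexCube v₀) ∷ []
    based []            = ∼-sym ∼-zero
    based ((n , σ) ∷ c) = ∼-trans (++-cong {a = _ ∷ []} (coeff-cong (ℤP.*-identityʳ n)) (based c)) (∼-merge (λ _ → refl))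

module _ {X : RGraph} (level : Vtx X → ℕ) (level-near : ∀ {u v} → Near X u v → level u ≤ suc (level v)) where

  cube-level-spread : ∀ {k} (σ : RCube X k) x y → level (corner σ x) ≤ level (corner σ y) ℕ.+ k
  cube-level-spread {zero}  σ [] [] = ℕP.≤-reflexive (sym (ℕP.+-identityʳ _))
  cube-level-spread {suc k} σ (a ∷ x) (b ∷ y) = begin
      level (corner σ (a ∷ x))            ≤⟨ cube-level-spread (facet fz a σ) x y ⟩
      level (corner σ (a ∷ y)) ℕ.+ k      ≤⟨ ℕP.+-monoˡ-≤ k (first-step a b) ⟩
      suc (level (corner σ (b ∷ y))) ℕ.+ k ≡⟨ ℕP.+-suc _ k ⟨
      level (corner σ (b ∷ y)) ℕ.+ suc k  ∎
    where
    open ℕP.≤-Reasoning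
    first-step : ∀ a b → level (corner σ (a ∷ y)) ≤ suc (level (corner σ (b ∷ y)))
    first-step false false = ℕP.n≤1+n _
    first-step true  true  = ℕP.n≤1+n _
    first-step false true  = level-near (corner-near σ here)
    first-step true  false = level-near (corner-near σ here)

module Suspension (G : Graph) (p : ℕ) where

  SG : Graph
  SG = S (suc (suc p)) (s≤s (s≤s z≤n)) G

  X GX : RGraph
  X  = toRGraph SG
  GX = toRGraph G


  level : Vtx X → ℕ
  level bot       = 0
  level top       = suc (suc p)
  level (mid v i) = suc (toℕ i)

  level-near : ∀ {u v} → Near X u v → level u ≤ suc (level v)
  level-near (inj₁ refl) = ℕP.n≤1+n _
  level-near {bot}     {mid v i} (inj₂ r) = z≤n
  level-near {mid v i} {bot}     (inj₂ r) = s≤s (ℕP.≤-reflexive r)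
  level-near {top}     {mid v i} (inj₂ r) = s≤s (ℕP.≤-reflexive (sym r))
  level-near {mid v i} {top}     (inj₂ r) = s≤s (ℕP.≤-trans (ℕP.<⇒≤ (FP.toℕ<n i)) (ℕP.n≤1+n _))
  level-near {mid v i} {mid w j} (inj₂ (inj₁ (_ , refl)))      = s≤s (ℕP.n≤1+n _)
  level-near {mid v i} {mid w j} (inj₂ (inj₂ (_ , inj₁ i<j))) =
    s≤s (ℕP.≤-trans (ℕP.n≤1+n _) (ℕP.≤-trans (ℕP.≤-reflexive i<j) (ℕP.n≤1+n _)))
  level-near {mid v i} {mid w j} (inj₂ (inj₂ (_ , inj₂ j<i))) = s≤s (ℕP.≤-reflexive (sym j<i))

  notTop notBot inMiddle : Vtx X → Bool
  notTop top = false
  notTop _   = true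
  notBot bot = false
  notBot _   = true
  inMiddle x = notTop x ∧ notBot x

  module Lower  = Induced X notTop   (cong notTop)
  module Upper  = Induced X notBot   (cong notBot)
  module Middle = Induced X inMiddle (cong inMiddle)

  -- top and bot are p + 2 apart, so no cube of dimension at most p + 1 meets both
  small-cube-misses-bot : ∀ {k} → k ≤ suc p → (σ : RCube X k) → ¬ Lower.Inside σ → Upper.Inside σ
  small-cube-misses-bot {k} k≤ σ ¬low y with corner σ y in eq
  ... | top     = tt
  ... | mid _ _ = tt
  ... | bot     = ⊥-elim (¬low λ x → not-top x (cube-level-spread level level-near σ x y))
    where
    not-top : ∀ x → level (corner σ x) ≤ level (corner σ y) ℕ.+ k → T (notTop (corner σ x))
    not-top x ≤k with corner σ x
    ... | bot     = tt
    ... | mid _ _ = tt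
    ... | top     = ⊥-elim (ℕP.<-irrefl refl
                      (ℕP.≤-trans ≤k (ℕP.≤-trans (ℕP.≤-reflexive (cong (λ z → level z ℕ.+ k) eq)) k≤)))

  descend : (x : Vtx X) → T (notTop x) → Vtx X
  descend bot            _ = bot
  descend (mid v fz)     _ = bot
  descend (mid v (fs i)) _ = mid v (inject₁ i)

  descend-notTop : ∀ x q → T (notTop (descend x q))
  descend-notTop bot            _ = tt
  descend-notTop (mid v fz)     _ = tt
  descend-notTop (mid v (fs i)) _ = tt

  descend-step : ∀ v i j → suc (toℕ i) ≡ toℕ j → Near X (descend (mid v i) tt) (descend (mid v j) tt)
  descend-step v fz     (fs j) h = inj₂ (trans (FP.toℕ-inject₁ j) (sym (ℕP.suc-injective h)))
  descend-step v (fs i) (fs j) h = inj₂ (inj₂ (refl , inj₁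
    (trans (cong suc (FP.toℕ-inject₁ i)) (trans (ℕP.suc-injective h) (sym (FP.toℕ-inject₁ j))))))

  descend-near : ∀ {x y} q q′ → Near X x y → Near X (descend x q) (descend y q′)
  descend-near {bot}          {bot}          _ _ r = inj₁ refl
  descend-near {bot}          {mid v fz}     _ _ r = inj₁ refl
  descend-near {bot}          {mid v (fs i)} _ _ (inj₂ ())
  descend-near {mid v fz}     {bot}          _ _ r = inj₁ refl
  descend-near {mid v (fs i)} {bot}          _ _ (inj₂ ())
  descend-near {mid v i}      {mid w j}      _ _ (inj₁ refl) = inj₁ refl
  descend-near {mid v fz}     {mid w .fz}    _ _ (inj₂ (inj₁ (e , refl))) = inj₁ refl
  descend-near {mid v (fs i)} {mid w .(fs i)} _ _ (inj₂ (inj₁ (e , refl))) = inj₂ (inj₁ (e , refl))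
  descend-near {mid v i}      {mid .v j}     _ _ (inj₂ (inj₂ (refl , inj₁ h))) = descend-step v i j h
  descend-near {mid v i}      {mid .v j}     _ _ (inj₂ (inj₂ (refl , inj₂ h))) = near-sym X (descend-step v j i h)

  descend-same : ∀ {x y} q q′ → x ≡ y → descend x q ≡ descend y q′
  descend-same {bot}          _ _ refl = refl
  descend-same {mid v fz}     _ _ refl = refl
  descend-same {mid v (fs i)} _ _ refl = refl

  lower : RMap Lower.Sub Lower.Sub
  lower = record
    { vmap      = λ (x , q) → descend x q , descend-notTop x q
    ; vmap-near = λ {(_ , q)} {(_ , q′)} → descend-near q q′
    ; vmap-same = λ {(_ , q)} {(_ , q′)} → descend-same q q′ }

  lower-near : ∀ a → Near Lower.Sub (vmap lower a) a
  lower-near (bot , _)          = inj₁ refl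
  lower-near (mid v fz , _)     = inj₂ refl
  lower-near (mid v (fs i) , _) = inj₂ (inj₂ (refl , inj₁ (cong suc (FP.toℕ-inject₁ i))))

  lower-iterate : ∀ n (a : Vtx Lower.Sub) → level (proj₁ a) ≤ n → proj₁ (vmap (lower ^ᴿ n) a) ≡ bot
  lower-iterate zero    (bot , _)          _         = refl
  lower-iterate (suc n) (bot , q)          _         = lower-iterate n (bot , q) z≤n
  lower-iterate (suc n) (mid v fz , q)     _         = lower-iterate n (bot , tt) z≤n
  lower-iterate (suc n) (mid v (fs i) , q) (s≤s le) =
    lower-iterate n (mid v (inject₁ i) , tt) (ℕP.≤-trans (ℕP.≤-reflexive (cong suc (FP.toℕ-inject₁ i))) le)

  lower-level : ∀ (a : Vtx Lower.Sub) → level (proj₁ a) ≤ suc p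
  lower-level (bot , _)     = z≤n
  lower-level (mid v i , _) = FP.toℕ<n i

  lower-reducedAcyclic : ∀ m → ReducedAcyclic Lower.Sub (suc m)
  lower-reducedAcyclic m = retract-reducedAcyclic lower lower-near (suc p) toPoint fromPoint
    (λ a → lower-iterate (suc p) a (lower-level a)) (point-reducedAcyclic m)
    where
    toPoint : RMap Lower.Sub Point
    toPoint = record { vmap = λ _ → tt ; vmap-near = λ _ → tt ; vmap-same = λ _ → tt }
    fromPoint : RMap Point Lower.Sub
    fromPoint = record { vmap = λ _ → bot , tt ; vmap-near = λ _ → inj₁ refl ; vmap-same = λ _ → refl }

  lower-bounds : ∀ {m} {c : RChain X (suc m)} → Every Lower.Inside c → Cycle c → IsBoundary c
  lower-bounds ins z = let (e , _ , c∼) = Lower.bounds-inside ins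
                             (lower-reducedAcyclic _ _ (Lower.restrict-reducedCycle ins z)) in e , c∼

  flipᵛ : Vtx X → Vtx X
  flipᵛ bot       = top
  flipᵛ top       = bot
  flipᵛ (mid v i) = mid v (opposite i)

  flipᵛ-involutive : ∀ x → flipᵛ (flipᵛ x) ≡ x
  flipᵛ-involutive bot       = refl
  flipᵛ-involutive top       = refl
  flipᵛ-involutive (mid v i) = cong (mid v) (FP.opposite-involutive i)

  opposite-step : ∀ (i j : Fin (suc p)) → suc (toℕ i) ≡ toℕ j → suc (toℕ (opposite j)) ≡ toℕ (opposite i)
  opposite-step i j h = begin
    suc (toℕ (opposite j))   ≡⟨ cong suc (FP.opposite-prop j) ⟩
    suc (p ∸ toℕ j)          ≡⟨ cong (λ z → suc (p ∸ z)) h ⟨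
    suc (p ∸ suc (toℕ i))    ≡⟨ ℕP.+-∸-assoc 1 (ℕP.≤-trans (ℕP.≤-reflexive h) (ℕP.≤-pred (FP.toℕ<n j))) ⟨
    p ∸ toℕ i                ≡⟨ FP.opposite-prop i ⟨
    toℕ (opposite i)         ∎
    where open ≡-Reasoning

  flipᵛ-near : ∀ {x y} → Near X x y → Near X (flipᵛ x) (flipᵛ y)
  flipᵛ-near (inj₁ refl) = inj₁ refl
  flipᵛ-near {bot}     {mid v i} (inj₂ r) = inj₂ (cong suc (trans (FP.opposite-prop i) (cong (p ∸_) r)))
  flipᵛ-near {mid v i} {bot}     (inj₂ r) = inj₂ (cong suc (trans (FP.opposite-prop i) (cong (p ∸_) r)))
  flipᵛ-near {top}     {mid v i} (inj₂ r) =
    inj₂ (trans (FP.opposite-prop i) (trans (cong (p ∸_) (ℕP.suc-injective r)) (ℕP.n∸n≡0 p)))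
  flipᵛ-near {mid v i} {top}     (inj₂ r) =
    inj₂ (trans (FP.opposite-prop i) (trans (cong (p ∸_) (ℕP.suc-injective r)) (ℕP.n∸n≡0 p)))
  flipᵛ-near {mid v i} {mid w j} (inj₂ (inj₁ (e , refl)))    = inj₂ (inj₁ (e , refl))
  flipᵛ-near {mid v i} {mid w j} (inj₂ (inj₂ (refl , inj₁ h))) = inj₂ (inj₂ (refl , inj₂ (opposite-step i j h)))
  flipᵛ-near {mid v i} {mid w j} (inj₂ (inj₂ (refl , inj₂ h))) = inj₂ (inj₂ (refl , inj₁ (opposite-step j i h)))

  flip : RMap X X
  flip = record { vmap = flipᵛ ; vmap-near = flipᵛ-near ; vmap-same = cong flipᵛ }

  upper-bounds : ∀ {m} {c : RChain X (suc m)} → Every Upper.Inside c → Cycle c → IsBoundary c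
  upper-bounds {c = c} ins z = let (e , flipped∼) = push-isBoundary flip (lower-bounds flipped-inside (push-cycle flip {c} z)) in
    e , ∼-trans (∼-sym flip²c∼c) flipped∼
    where
    flipped-inside : Every Lower.Inside (push flip c)
    flipped-inside = Every-linear ([_]ᶜ ∘ mapCube flip) (λ σ q → (λ x → to-lower (corner σ x) (q x)) ∷ []) ins
      where
      to-lower : ∀ x → T (notBot x) → T (notTop (flipᵛ x))
      to-lower top       _ = tt
      to-lower (mid v i) _ = tt
    flip²c∼c : push flip (push flip c) ∼ c
    flip²c∼c = ∼-trans (push-∘ flip flip c) (∼-trans (push-ext {φ = flip ∘ᴿ flip} {ψ = idᴿ} flipᵛ-involutive c) (push-id c))

  squash : (x : Vtx X) → T (inMiddle x) → Vtx X
  squash (mid v fz)     _ = mid v fz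
  squash (mid v (fs i)) _ = mid v (inject₁ i)

  squash-inMiddle : ∀ x q → T (inMiddle (squash x q))
  squash-inMiddle (mid v fz)     _ = tt
  squash-inMiddle (mid v (fs i)) _ = tt

  squash-step : ∀ v i j → suc (toℕ i) ≡ toℕ j → Near X (squash (mid v i) tt) (squash (mid v j) tt)
  squash-step v fz     (fs fz)     h = inj₁ refl
  squash-step v (fs i) (fs j)      h = inj₂ (inj₂ (refl , inj₁
    (trans (cong suc (FP.toℕ-inject₁ i)) (trans (ℕP.suc-injective h) (sym (FP.toℕ-inject₁ j))))))

  squash-near : ∀ {x y} q q′ → Near X x y → Near X (squash x q) (squash y q′)
  squash-near {mid v i}      {mid w j}       _ _ (inj₁ refl) = inj₁ refl
  squash-near {mid v fz}     {mid w .fz}     _ _ (inj₂ (inj₁ (e , refl))) = inj₂ (inj₁ (e , refl))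
  squash-near {mid v (fs i)} {mid w .(fs i)} _ _ (inj₂ (inj₁ (e , refl))) = inj₂ (inj₁ (e , refl))
  squash-near {mid v i}      {mid .v j}      _ _ (inj₂ (inj₂ (refl , inj₁ h))) = squash-step v i j h
  squash-near {mid v i}      {mid .v j}      _ _ (inj₂ (inj₂ (refl , inj₂ h))) = near-sym X (squash-step v j i h)

  squash-same : ∀ {x y} q q′ → x ≡ y → squash x q ≡ squash y q′
  squash-same {mid v fz}     _ _ refl = refl
  squash-same {mid v (fs i)} _ _ refl = refl

  sink : RMap Middle.Sub Middle.Sub
  sink = record
    { vmap      = λ (x , q) → squash x q , squash-inMiddle x q
    ; vmap-near = λ {(_ , q)} {(_ , q′)} → squash-near q q′
    ; vmap-same = λ {(_ , q)} {(_ , q′)} → squash-same q q′ }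

  sink-near : ∀ a → Near Middle.Sub (vmap sink a) a
  sink-near (mid v fz , _)     = inj₁ refl
  sink-near (mid v (fs i) , _) = inj₂ (inj₂ (refl , inj₁ (cong suc (FP.toℕ-inject₁ i))))

  project : RMap Middle.Sub GX
  project = record { vmap = base ; vmap-near = base-near ; vmap-same = base-same }
    where
    base : Vtx Middle.Sub → V G
    base (mid v _ , _) = v
    base-near : ∀ {a b} → Near Middle.Sub a b → Near GX (base a) (base b)
    base-near {mid v i , _} {mid w j , _} (inj₁ refl)           = inj₁ refl
    base-near {mid v i , _} {mid w j , _} (inj₂ (inj₁ (e , _))) = inj₂ e
    base-near {mid v i , _} {mid w j , _} (inj₂ (inj₂ (e , _))) = inj₁ e
    base-same : ∀ {a b} → Same Middle.Sub a b → base a ≡ base b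
    base-same {mid v i , _} refl = refl

  embed : RMap GX Middle.Sub
  embed = record { vmap = λ v → mid v fz , tt ; vmap-near = near ; vmap-same = cong (λ v → mid v fz) }
    where
    near : ∀ {u v} → Near GX u v → Near Middle.Sub (mid u fz , tt) (mid v fz , tt)
    near (inj₁ refl) = inj₁ refl
    near (inj₂ e)    = inj₂ (inj₁ (e , refl))

  sink-iterate : ∀ n (a : Vtx Middle.Sub) → level (proj₁ a) ≤ suc n → proj₁ (vmap (sink ^ᴿ n) a) ≡ proj₁ (vmap (embed ∘ᴿ project) a)
  sink-iterate zero    (mid v fz , _)     _        = refl
  sink-iterate zero    (mid v (fs i) , _) (s≤s ())
  sink-iterate (suc n) (mid v fz , q)     _        = sink-iterate n (mid v fz , tt) (s≤s z≤n)
  sink-iterate (suc n) (mid v (fs i) , q) (s≤s le) =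
    sink-iterate n (mid v (inject₁ i) , tt) (ℕP.≤-trans (ℕP.≤-reflexive (cong suc (FP.toℕ-inject₁ i))) le)

  middle-reducedAcyclic : ∀ {k} → ReducedAcyclic GX k → ReducedAcyclic Middle.Sub k
  middle-reducedAcyclic = retract-reducedAcyclic sink sink-near p project embed
    (λ { a@(mid v i , _) → sink-iterate p a (FP.toℕ<n i) })

  Every-middle⇒lower : ∀ {k} {c : RChain X k} → Every Middle.Inside c → Every Lower.Inside c
  Every-middle⇒lower = All.map λ q x → proj₁ (Equivalence.to T-∧ (q x))

  Every-middle⇒upper : ∀ {k} {c : RChain X k} → Every Middle.Inside c → Every Upper.Inside c
  Every-middle⇒upper = All.map λ q x → proj₂ (Equivalence.to T-∧ (q x))

  Every-lower∧upper⇒middle : ∀ {k} {c : RChain X k} → Every Lower.Inside c → Every Upper.Inside c → Every Middle.Inside c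
  Every-lower∧upper⇒middle l u = All.zipWith (λ (l , u) x → Equivalence.from T-∧ (l x , u x)) (l , u)

  interface-bounds : ∀ {k} → ReducedAcyclic GX k → ∀ {z w : RChain X k} →
                     Every Lower.Inside z → Every Upper.Inside w → z ∼ w → ReducedCycle z →
                     Σ (RChain X (suc k)) λ e → Every Middle.Inside e × z ∼ boundary e
  interface-bounds acyclic {z} {w} low up z∼w cyc =
    let (e , ins , zM∼∂e) = Middle.bounds-inside zM-middle
                              (middle-reducedAcyclic acyclic _ (Middle.restrict-reducedCycle zM-middle zM-cycle))
    in e , ins , ∼-trans (∼-sym zM∼z) zM∼∂e
    where
    zM = Upper.keep z
    zM∼z : zM ∼ z
    zM∼z = ∼-trans (push-cong Upper.incl (Upper.restrict-cong z∼w)) (∼-trans (Upper.keep-inside up) (∼-sym z∼w))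
    zM-middle : Every Middle.Inside zM
    zM-middle = Every-lower∧upper⇒middle (Upper.keep-Every low) (Upper.Every-Inside-keep z)
    zM-cycle : ReducedCycle zM
    zM-cycle = reducedCycle-cong (∼-sym zM∼z) cyc

  -- the Mayer–Vietoris gluing: correct both halves by a chain e of the middle with ∂e = ∂cL
  glue-bounds : ∀ {m} {cL cU e : RChain X (suc m)} → Every Lower.Inside cL → Every Upper.Inside cU →
                Every Middle.Inside e → boundary cL ∼ boundary e → boundary (cL ++ cU) ∼ [] → IsBoundary (cL ++ cU)
  glue-bounds {cL = cL} {cU} {e} low up inMid ∂cL∼∂e cyc =
    let (EL , lower∼) = lower-bounds (++⁺ low (Every-scale -1ℤ (Every-middle⇒lower inMid))) lower-cycle
        (EU , upper∼) = upper-bounds (++⁺ up (Every-middle⇒upper inMid)) upper-cycle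
    in EL ++ EU , (begin
      cL ++ cU                              ≡⟨ ++-identityʳ (cL ++ cU) ⟨
      (cL ++ cU) ++ []                      ≈⟨ ++-congˡ (cL ++ cU) (neg-inverseˡ e) ⟨
      (cL ++ cU) ++ (neg e ++ e)            ≈⟨ ++-interchange cL (neg e) cU e ⟨
      (cL ++ neg e) ++ (cU ++ e)            ≈⟨ ++-cong lower∼ upper∼ ⟩
      boundary EL ++ boundary EU            ≡⟨ boundary-++ EL EU ⟨
      boundary (EL ++ EU)                   ∎)
    where
    open ∼-Reasoning
    lower-cycle : boundary (cL ++ neg e) ∼ []
    lower-cycle = begin
      boundary (cL ++ neg e)                ≡⟨ trans (boundary-++ cL (neg e)) (cong (boundary cL ++_) (boundary-neg e)) ⟩
      boundary cL ++ neg (boundary e)       ≈⟨ ++-congʳ (neg (boundary e)) ∂cL∼∂e ⟩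
      boundary e ++ neg (boundary e)        ≈⟨ neg-inverseʳ (boundary e) ⟩
      []                                    ∎
    upper-cycle : boundary (cU ++ e) ∼ []
    upper-cycle = begin
      boundary (cU ++ e)                    ≡⟨ boundary-++ cU e ⟩
      boundary cU ++ boundary e             ≈⟨ ++-congˡ (boundary cU) ∂cL∼∂e ⟨
      boundary cU ++ boundary cL            ≈⟨ ++-comm-∼ (boundary cU) (boundary cL) ⟩
      boundary cL ++ boundary cU            ≡⟨ boundary-++ cL cU ⟨
      boundary (cL ++ cU)                   ≈⟨ cyc ⟩
      []                                    ∎

  suspension-reducedAcyclic : ∀ {k} → k ≤ p → ReducedAcyclic GX k → ReducedAcyclic X (suc k)
  suspension-reducedAcyclic k≤p acyclic c cyc =
    let (e , inMid , ∂cL∼∂e) = interface-bounds acyclic ∂low (Every-scale -1ℤ ∂up)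
                               ∂cL∼-∂cU (boundary-reducedCycle cL)
        (E , split∼∂E) = glue-bounds low up inMid ∂cL∼∂e (∼-trans (boundary-cong (∼-sym c∼split)) cyc)
    in E , ∼-trans c∼split split∼∂E
    where
    cL = Lower.keep c
    cU = Lower.discard c
    c∼split : c ∼ cL ++ cU
    c∼split = Lower.keep-discard c
    low : Every Lower.Inside cL
    low = Lower.Every-Inside-keep c
    up : Every Upper.Inside cU
    up = All.map (λ {(_ , σ)} → small-cube-misses-bot (s≤s k≤p) σ) (Lower.discard-outside c)
    ∂low : Every Lower.Inside (boundary cL)
    ∂low = Every-boundary {Q = T ∘ notTop} low
    ∂up : Every Upper.Inside (boundary cU)
    ∂up = Every-boundary {Q = T ∘ notBot} up
    ∂cL∼-∂cU : boundary cL ∼ neg (boundary cU)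
    ∂cL∼-∂cU = ++-∼[]⇒∼neg (boundary cL) (boundary cU)
                 (∼-trans (∼-reflexive (sym (boundary-++ cL cU))) (∼-trans (boundary-cong (∼-sym c∼split)) cyc))

  walk-down : ∀ n v (i : Fin (suc p)) → toℕ i ≡ n → Star (E SG) (mid v i) bot
  walk-down zero    v fz     _ = refl ◅ ε
  walk-down (suc n) v (fs i) h =
    inj₂ (refl , inj₂ (cong suc (FP.toℕ-inject₁ i))) ◅ walk-down n v (inject₁ i) (trans (FP.toℕ-inject₁ i) (ℕP.suc-injective h))

  walk-to-bot : V G → ∀ x → Star (E SG) x bot
  walk-to-bot v₀ bot       = ε
  walk-to-bot v₀ (mid v i) = walk-down _ v i refl
  walk-to-bot v₀ top       = cong suc (FP.toℕ-fromℕ p) ◅ walk-down _ v₀ (fromℕ p) refl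

  suspension-connected : Connected G → Connected SG
  suspension-connected (v₀ , _) = bot , λ u v → walk-to-bot v₀ u ◅◅ reverse (SE-sym G (suc (suc p))) (walk-to-bot v₀ v)

module _ (G : Graph) where
  private
    X = toRGraph G

  toRChain : ∀ {k} → Chain G k → RChain X k
  toRChain = map λ (n , σ) → n , rcube (fun σ) (map-adj σ)

  fromRChain : ∀ {k} → RChain X k → Chain G k
  fromRChain = map λ (n , σ) → n , cube (corner σ) (corner-near σ)

  from-toRChain : ∀ {k} (c : Chain G k) → fromRChain (toRChain c) ≡ c
  from-toRChain []      = refl
  from-toRChain (x ∷ c) = cong (x ∷_) (from-toRChain c)

  to-fromRChain : ∀ {k} (c : RChain X k) → toRChain (fromRChain c) ≡ c
  to-fromRChain []      = refl
  to-fromRChain (x ∷ c) = cong (x ∷_) (to-fromRChain c)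

  ≈⇒∼ : ∀ {k} {a b : Chain G k} → a ≈ b → toRChain a ∼ toRChain b
  ≈⇒∼ ≈refl        = ∼-refl
  ≈⇒∼ (≈sym p)     = ∼-sym (≈⇒∼ p)
  ≈⇒∼ (≈trans p q) = ∼-trans (≈⇒∼ p) (≈⇒∼ q)
  ≈⇒∼ (≈++ {a} {b} {c} {d} p q) =
    ∼-trans (∼-reflexive (map-++ _ a c)) (∼-trans (++-cong (≈⇒∼ p) (≈⇒∼ q)) (∼-reflexive (sym (map-++ _ b d))))
  ≈⇒∼ ≈swap        = ∼-swap
  ≈⇒∼ (≈merge e)   = ∼-merge e
  ≈⇒∼ ≈zero        = ∼-zero
  ≈⇒∼ (≈degen {σ = σ} d) = ∼-degen (degenerate σ d)
    where
    degenerate : ∀ {k} (σ : Cube G k) → Degenerate σ → IsDegenerate (rcube (fun σ) (map-adj σ))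
    degenerate {suc m} σ d = d

  ∼⇒≈ : ∀ {k} {a b : RChain X k} → a ∼ b → fromRChain a ≈ fromRChain b
  ∼⇒≈ ∼-refl        = ≈refl
  ∼⇒≈ (∼-sym p)     = ≈sym (∼⇒≈ p)
  ∼⇒≈ (∼-trans p q) = ≈trans (∼⇒≈ p) (∼⇒≈ q)
  ∼⇒≈ (++-cong {a} {b} {c} {d} p q) = subst₂ _≈_ (sym (map-++ _ a c)) (sym (map-++ _ b d)) (≈++ (∼⇒≈ p) (∼⇒≈ q))
  ∼⇒≈ ∼-swap        = ≈swap
  ∼⇒≈ (∼-merge e)   = ≈merge e
  ∼⇒≈ ∼-zero        = ≈zero
  ∼⇒≈ (∼-degen {σ = σ} d) = ≈degen (degenerate σ d)
    where
    degenerate : ∀ {k} (σ : RCube X k) → IsDegenerate σ → Degenerate (cube (corner σ) (corner-near σ))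
    degenerate {suc m} σ d = d

  ∂-fromRChain : ∀ {m} (d : RChain X (suc m)) → ∂ (fromRChain d) ≡ fromRChain (boundary d)
  ∂-fromRChain []            = refl
  ∂-fromRChain {m} ((n , σ) ∷ d) =
    trans (cong₂ _++_ (sym (trans (map-scale n (cubeBoundary σ)) (cong (map _) (from-pairs (allFin (suc m))))))
                      (∂-fromRChain d))
          (sym (map-++ _ (scale n (cubeBoundary σ)) (boundary d)))
    where
    from-pairs : ∀ L → fromRChain (concatMap (boundary-pair σ) L) ≡
      concatMap (λ i → (sgn (suc (toℕ i)) , face i false (cube (corner σ) (corner-near σ)))
                     ∷ (- sgn (suc (toℕ i)) , face i true (cube (corner σ) (corner-near σ))) ∷ []) L
    from-pairs []      = refl
    from-pairs (i ∷ L) = cong (λ z → _ ∷ _ ∷ z) (from-pairs L)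
    map-scale : ∀ {k} n (c : RChain X k) → fromRChain (scale n c) ≡ map (λ (a , τ) → n ℤ.* a , τ) (fromRChain c)
    map-scale n []      = refl
    map-scale n (x ∷ c) = cong (_ ∷_) (map-scale n c)

  homologyVanishes : ∀ {m} → ReducedAcyclic X (suc m) → HomologyVanishes G (suc m)
  homologyVanishes acyclic c cyc =
    let (d , c∼∂d) = acyclic (toRChain c) reduced-cycle
    in fromRChain d , subst₂ _≈_ (from-toRChain c) (sym (∂-fromRChain d)) (∼⇒≈ c∼∂d)
    where
    reduced-cycle : boundary (toRChain c) ∼ []
    reduced-cycle = ∼-trans (∼-reflexive (sym (trans (cong toRChain (trans (cong ∂ (sym (from-toRChain c)))
                                                                           (∂-fromRChain (toRChain c))))
                                                      (to-fromRChain _))))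
                            (≈⇒∼ cyc)

module _ (G₁ : Graph) (connected : Connected G₁) where

  Gseq-connected : ∀ n → Connected (Gseq G₁ (suc n))
  Gseq-connected zero    = connected
  Gseq-connected (suc n) = Suspension.suspension-connected (Gseq G₁ (suc n)) (suc (suc n)) (Gseq-connected n)

  Gseq-reducedAcyclic : ∀ n k → k < suc n → ReducedAcyclic (toRGraph (Gseq G₁ (suc n))) k
  Gseq-reducedAcyclic n       zero    _         = connected⇒reducedAcyclic₀ (Gseq G₁ (suc n)) (Gseq-connected n)
  Gseq-reducedAcyclic (suc n) (suc k) (s≤s k<n) =
    Suspension.suspension-reducedAcyclic (Gseq G₁ (suc n)) (suc (suc n))
      (ℕP.≤-trans (ℕP.<⇒≤ k<n) (ℕP.n≤1+n (suc n)))
      (Gseq-reducedAcyclic n k k<n)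

proposition5p12 : (G₁ : Graph) → Connected G₁ →
    (n : ℕ) → 2 ≤ n → (k : ℕ) → 1 ≤ k → k < n →
    HomologyVanishes (Gseq G₁ n) k
proposition5p12 G₁ connected (suc n) _ (suc m) _ k<n =
  homologyVanishes (Gseq G₁ (suc n)) (Gseq-reducedAcyclic G₁ connected n (suc m) k<n)
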